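{- Let $d \geq 2$ and let $\mathcal{C}$ be a pure $d$-dimensional $1$-decomposable simplicial complex with vertex set $[n]=\{1,\dots,n\}$. Let $H$ be a set of $d-2$ new elements disjoint from $[n]$, and let $\Delta_{n+d-3}^{(d)}$ denote the $d$-skeleton of the simplex on the $n+d-2$ vertices $[n]\cup H$, i.e. the complex whose facets are all $(d+1)$-element subsets of $[n]\cup H$. Then the facets of $\Delta_{n+d-3}^{(d)}$ that are not facets of $\mathcal{C}$ can be ordered as $F_1,\dots,F_t$ so that $\mathcal{C} + \langle F_1,\dots,F_i \rangle$ is $1$-decomposable for all $1 \leq i \leq t$.
   Context: A simplicial complex on a finite ground set $V$ is a collection of subsets of $V$ closed under taking subsets; its elements are faces, elements $v$ with $\{v\}$ a face are vertices, maximal faces are facets, and the dimension of a face $F$ is $|F|-1$. A complex is pure if all facets have the same cardinality; its dimension is the maximum facet dimension. $\langle F_1,\dots,F_k\rangle$ denotes the complex whose facets are $F_1,\dots,F_k$. For a complex $\mathcal{C}$ and sets $G_1,\dots,G_k$ of the same dimension as $\mathcal{C}$, $\mathcal{C}+\langle G_1,\dots,G_k\rangle$ denotes the complex generated by the facets of $\mathcal{C}$ together with $G_1,\dots,G_k$. For a nonempty face $F$ of $\mathcal{C}$: the link is $\mathrm{lk}_F\mathcal{C}=\{G\in\mathcal{C}: G\cap F=\emptyset,\ G\cup F\in\mathcal{C}\}$ and the deletion is $\mathrm{del}_F\mathcal{C}=\{G\in\mathcal{C}: F\not\subseteq G\}$. A pure $d$-dimensional complex $\mathcal{C}$ is $k$-decomposable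 if either $\mathcal{C}$ is a simplex (has exactly one facet), or there is a face $F$ of $\mathcal{C}$ with $\dim F\le k$ such that $\mathrm{del}_F\mathcal{C}$ and $\mathrm{lk}_F\mathcal{C}$ are both $k$-decomposable and $\mathrm{del}_F\mathcal{C}$ is pure of the same dimension $d$ as $\mathcal{C}$ (a face satisfying this last purity condition is called a shedding face). -}

module Defs where

open import Level using (0ℓ) renaming (suc to lsuc)
open import Data.Nat using (ℕ; suc; _≤_; _<_; _+_; _∸_)
open import Data.Fin using (Fin; toℕ)
open import Data.Fin.Subset using (Subset; _⊆_; _∩_; _∪_; ∣_∣; ⁅_⁆; Nonempty; ⊥)
open import Data.Product using (Σ; ∃; _×_)
open import Data.Sum using (_⊎_)
open import Data.List using (List)
open import Data.List.Relation.Unary.Any using (Any)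
open import Relation.Binary.PropositionalEquality using (_≡_)
open import Relation.Nullary using (¬_)

Cx : ℕ → Set₁
Cx N = Subset N → Set

module _ {N : ℕ} where

  IsComplex : Cx N → Set
  IsComplex K = ∀ F G → G ⊆ F → K F → K G

  Facet : Cx N → Subset N → Set
  Facet K F = K F × (∀ G → K G → F ⊆ G → G ≡ F)

  -- pure with all facets of cardinality c (i.e. dimension c - 1), and
  -- (since the dimension is c - 1) at least one facet exists
  PureCard : Cx N → ℕ → Set
  PureCard K c = (∃ λ F → Facet K F) × (∀ F → Facet K F → ∣ F ∣ ≡ c)

  IsSimplex : Cx N → Set
  IsSimplex K = ∃ λ F → Facet K F × (∀ G → Facet K G → G ≡ F)

  lk : Subset N → Cx N → Cx N
  lk F K G = K G × (G ∩ F ≡ ⊥) × K (G ∪ F)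

  del : Subset N → Cx N → Cx N
  del F K G = K G × ¬ (F ⊆ G)

  -- k-decomposability (a complex with facets of cardinality c has dimension c - 1;
  -- a face F has dim F ≤ k iff ∣ F ∣ ≤ k + 1)
  data KDecomposable (k : ℕ) : Cx N → Set₁ where
    simplex : ∀ {K} c → PureCard K c → IsSimplex K → KDecomposable k K
    shed    : ∀ {K} c → PureCard K c →
              (F : Subset N) → K F → Nonempty F → ∣ F ∣ ≤ suc k →
              PureCard (del F K) c →
              KDecomposable k (lk F K) →
              KDecomposable k (del F K) →
              KDecomposable k K

  _+⟨_⟩ : Cx N → List (Subset N) → Cx N
  (C +⟨ Gs ⟩) G = C G ⊎ Any (G ⊆_) Gs

-- Induction on d, adding one new vertex h ∈ H at a time.
--
-- For d = 2 there are no new vertices. The graph of a pure 1-decomposable complex is connected, so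
-- while some edge ab on [n] is missing, a path from a to b contains a wedge a′x, xb′ whose third
-- edge a′b′ is missing; adding the triangle a′xb′ keeps the complex 1-decomposable, with the new
-- edge a′b′ as shedding face. Once the graph is complete, the missing triangles can be added in any
-- order, because adding a facet whose whole boundary is present preserves decomposability.
--
-- For d > 2, the (d-1)-skeleton C′ of C is again 1-decomposable; by induction (with H - h) the
-- ridges R₁, …, Rₛ missing from C′ can be ordered, and the facets of C′ have an order B₁, …, Bₜ
-- whose initial segments generate decomposable complexes. Add first the cones hBᵢ (shedding h, the
-- deletion is C and the link ⟨B₁, …, Bᵢ⟩), then the cones hRⱼ (the result is the cone over
-- C′ + ⟨R₁, …, Rⱼ⟩ with the facets of C attached along their boundaries), and finally the remaining
-- d-faces, whose boundaries are all present by then.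
--
-- Only the shedding of edges for d = 2 needs k ≥ 1, so the argument works for every k ≥ 1.

module Submission where

open import Defs
open import Data.Nat using (ℕ; zero; suc; _+_; _∸_; _≤_; _<_; z≤n; s≤s; _≤?_)
import Data.Nat.Properties as ℕ
open import Data.Fin using (Fin; zero; suc; toℕ) renaming (_≟_ to _≟ᶠ_)
open import Data.Fin.Properties using (any?)
open import Data.Fin.Subset
open import Data.Fin.Subset.Properties
import Data.Bool.Properties as Bool
open import Data.Vec using ([]; _∷_; here; there)
import Data.Vec.Properties as Vec
open import Data.List using (List; []; _∷_; _++_; map; filter; length; take; drop)
import Data.List.Properties as List
open import Data.List.Membership.Propositional using (find; lose) renaming (_∈_ to _∈ˡ_)
open import Data.List.Membership.Propositional.Properties
open import Data.List.Relation.Unary.Any using (Any; here; there)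
import Data.List.Relation.Unary.Any as Any
import Data.List.Relation.Unary.Any.Properties as Any
open import Data.List.Relation.Unary.All using ([]; _∷_)
import Data.List.Relation.Unary.All as All
import Data.List.Relation.Unary.All.Properties as All
open import Data.List.Relation.Unary.AllPairs using ([]; _∷_)
open import Data.List.Relation.Unary.Unique.Propositional using (Unique)
import Data.List.Relation.Unary.Unique.Propositional.Properties as Unique
open import Data.Product using (Σ; ∃; _×_; _,_; proj₁; proj₂)
import Data.Product as Product
open import Data.Sum using (_⊎_; inj₁; inj₂; [_,_]′)
import Data.Sum as Sum
open import Data.Empty using (⊥-elim)
open import Function using (_∘_; id; case_of_)
open import Function.Bundles using (_⇔_; mk⇔; Equivalence)
import Function.Properties.Equivalence as ⇔
open import Relation.Nullary using (¬_; Dec; yes; no; contradiction)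
open import Relation.Nullary.Decidable using (_×-dec_; _⊎-dec_; ¬?)
open import Relation.Unary using (_≐_; Decidable) renaming (_∪_ to _∪ᶜ_)
open import Relation.Unary.Properties using (≐-sym; ≐-trans; _∪?_)
open import Relation.Binary.PropositionalEquality
open import Relation.Binary.Construct.Closure.ReflexiveTransitive using (Star; ε; _◅_; _◅◅_; reverse)
import Relation.Binary.Construct.Closure.ReflexiveTransitive as Star

private variable
  n N k c c′ : ℕ
  x y : Fin n
  a b h : Fin N
  p q r : Subset n
  F G R S T V H σ : Subset N
  K L D M M′ Q C : Cx N
  Fs Gs Ds Ws : List (Subset N)

-- Finite sets

_≟ˢ_ : (p q : Subset n) → Dec (p ≡ q)
_≟ˢ_ = Vec.≡-dec Bool._≟_

Disjoint : Subset n → Subset n → Set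
Disjoint p q = ∀ {x} → x ∈ p → x ∉ q

∩≡⊥⇒disjoint : p ∩ q ≡ ⊥ → Disjoint p q
∩≡⊥⇒disjoint p∩q≡⊥ {x} x∈p x∈q = ∉⊥ (subst (x ∈_) p∩q≡⊥ (x∈p∩q⁺ (x∈p , x∈q)))

disjoint⇒∩≡⊥ : Disjoint p q → p ∩ q ≡ ⊥
disjoint⇒∩≡⊥ {p = p} {q} p#q = Empty-unique λ (x , x∈p∩q) → let (x∈p , x∈q) = x∈p∩q⁻ p q x∈p∩q in p#q x∈p x∈q

∉⇒disjoint⁅⁆ : x ∉ p → Disjoint p ⁅ x ⁆
∉⇒disjoint⁅⁆ {p = p} x∉p y∈p y∈⁅x⁆ = x∉p (subst (_∈ p) (x∈⁅y⁆⇒x≡y _ y∈⁅x⁆) y∈p)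

p#∁p : ∀ (p : Subset n) → Disjoint p (∁ p)
p#∁p p x∈p x∈∁p = x∈∁p⇒x∉p x∈∁p x∈p

x∈p─q⇒x∉q : ∀ (p q : Subset n) → x ∈ p ─ q → x ∉ q
x∈p─q⇒x∉q (inside ∷ p) (outside ∷ q) here ()
x∈p─q⇒x∉q (_ ∷ p) (_ ∷ q) (there x∈p─q) (there x∈q) = x∈p─q⇒x∉q p q x∈p─q x∈q

x∈p-y⇒x≢y : ∀ (p : Subset n) → x ∈ p - y → x ≢ y
x∈p-y⇒x≢y {y = y} p x∈p-y = x∉⁅y⁆⇒x≢y (x∈p─q⇒x∉q p ⁅ y ⁆ x∈p-y)

p-x⊆p : ∀ (p : Subset n) x → p - x ⊆ p
p-x⊆p p x = p─q⊆p p ⁅ x ⁆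

x∉p-x : ∀ (p : Subset n) x → x ∉ p - x
x∉p-x p x x∈p-x = x∈p-y⇒x≢y p x∈p-x refl

⁅x⁆⊆p : x ∈ p → ⁅ x ⁆ ⊆ p
⁅x⁆⊆p {x = x} {p} x∈p y∈⁅x⁆ = subst (_∈ p) (sym (x∈⁅y⁆⇒x≡y x y∈⁅x⁆)) x∈p

⁅x⁆-x⊆p : ∀ (x : Fin n) → ⁅ x ⁆ - x ⊆ p
⁅x⁆-x⊆p x y∈ = contradiction (x∈⁅y⁆⇒x≡y x (p-x⊆p ⁅ x ⁆ x y∈)) (x∈p-y⇒x≢y ⁅ x ⁆ y∈)

∪-lub : p ⊆ r → q ⊆ r → p ∪ q ⊆ r
∪-lub {p = p} {q = q} p⊆r q⊆r x∈p∪q = [ p⊆r , q⊆r ]′ (x∈p∪q⁻ p q x∈p∪q)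

∪-monoˡ : ∀ r → p ⊆ q → p ∪ r ⊆ q ∪ r
∪-monoˡ {q = q} r p⊆q = ∪-lub (p⊆p∪q r ∘ p⊆q) (q⊆p∪q q r)

∪-cancelʳ : Disjoint p r → Disjoint q r → p ∪ r ≡ q ∪ r → p ≡ q
∪-cancelʳ {p = p} {r = r} {q = q} p#r q#r p∪r≡q∪r = ⊆-antisym (cancel p#r p∪r≡q∪r) (cancel q#r (sym p∪r≡q∪r))
  where
  cancel : ∀ {a b} → Disjoint a r → a ∪ r ≡ b ∪ r → a ⊆ b
  cancel {a} {b} a#r a∪r≡b∪r x∈a =
    [ id , ⊥-elim ∘ a#r x∈a ]′ (x∈p∪q⁻ b r (subst (_ ∈_) a∪r≡b∪r (p⊆p∪q r x∈a)))

p⊆q─r : p ⊆ q → Disjoint p r → p ⊆ q ─ r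
p⊆q─r p⊆q p#r x∈p = x∈p∧x∉q⇒x∈p─q (p⊆q x∈p) (p#r x∈p)

p⊆q-x : p ⊆ q → x ∉ p → p ⊆ q - x
p⊆q-x {p = p} p⊆q x∉p y∈p = x∈p∧x≢y⇒x∈p-y (p⊆q y∈p) λ { refl → x∉p y∈p }

p⊆q⇒p-x⊆q-x : p ⊆ q → p - x ⊆ q - x
p⊆q⇒p-x⊆q-x {p = p} {x = x} p⊆q y∈p-x =
  x∈p∧x≢y⇒x∈p-y (p⊆q (p-x⊆p p x y∈p-x)) (x∈p-y⇒x≢y p y∈p-x)

p⊆p─q∪q : ∀ (p q : Subset n) → p ⊆ (p ─ q) ∪ q
p⊆p─q∪q p q {y} y∈p with y ∈? q
... | yes y∈q = q⊆p∪q (p ─ q) q y∈q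
... | no y∉q = p⊆p∪q q (x∈p∧x∉q⇒x∈p─q y∈p y∉q)

p⊆p-x∪⁅x⁆ : ∀ (p : Subset n) x → p ⊆ (p - x) ∪ ⁅ x ⁆
p⊆p-x∪⁅x⁆ p x {y} y∈p with y ≟ᶠ x
... | yes refl = q⊆p∪q (p - x) ⁅ x ⁆ (x∈⁅x⁆ x)
... | no y≢x = p⊆p∪q ⁅ x ⁆ (x∈p∧x≢y⇒x∈p-y y∈p y≢x)

p∪⁅x⁆-x⊆p : ∀ (p : Subset n) x → (p ∪ ⁅ x ⁆) - x ⊆ p
p∪⁅x⁆-x⊆p p x y∈ with x∈p∪q⁻ p ⁅ x ⁆ (p-x⊆p _ x y∈)
... | inj₁ y∈p = y∈p
... | inj₂ y∈⁅x⁆ = contradiction (x∈⁅y⁆⇒x≡y x y∈⁅x⁆) (x∈p-y⇒x≢y _ y∈)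

p∪q-x⊆p-x∪q : ∀ (p q : Subset n) x → (p ∪ q) - x ⊆ (p - x) ∪ q
p∪q-x⊆p-x∪q p q x y∈ with x∈p∪q⁻ p q (p-x⊆p (p ∪ q) x y∈)
... | inj₁ y∈p = p⊆p∪q q (x∈p∧x≢y⇒x∈p-y y∈p (x∈p-y⇒x≢y (p ∪ q) y∈))
... | inj₂ y∈q = q⊆p∪q (p - x) q y∈q

p-x∪q⊆p∪q-x : ∀ (p q : Subset n) → x ∉ q → (p - x) ∪ q ⊆ (p ∪ q) - x
p-x∪q⊆p∪q-x p q x∉q = p⊆q-x (∪-monoˡ q (p-x⊆p p _)) λ x∈ → [ x∉p-x p _ , x∉q ]′ (x∈p∪q⁻ (p - _) q x∈)

p-x⊆q∪r-x : ∀ (p q r : Subset n) → p ⊆ q ∪ r → p - x ⊆ q ∪ (r - x)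
p-x⊆q∪r-x {x = x} p q r p⊆q∪r y∈p-x with x∈p∪q⁻ q r (p⊆q∪r (p-x⊆p p x y∈p-x))
... | inj₁ y∈q = p⊆p∪q (r - x) y∈q
... | inj₂ y∈r = q⊆p∪q q (r - x) (x∈p∧x≢y⇒x∈p-y y∈r (x∈p-y⇒x≢y p y∈p-x))

∣p∪q∣≡∣p∣+∣q∣ : ∀ (p q : Subset n) → Disjoint p q → ∣ p ∪ q ∣ ≡ ∣ p ∣ + ∣ q ∣
∣p∪q∣≡∣p∣+∣q∣ [] [] _ = refl
∣p∪q∣≡∣p∣+∣q∣ (inside ∷ p) (inside ∷ q) p#q = contradiction here (p#q here)
∣p∪q∣≡∣p∣+∣q∣ (inside ∷ p) (outside ∷ q) p#q = cong suc (∣p∪q∣≡∣p∣+∣q∣ p q (λ x∈p → p#q (there x∈p) ∘ there))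
∣p∪q∣≡∣p∣+∣q∣ (outside ∷ p) (inside ∷ q) p#q =
  trans (cong suc (∣p∪q∣≡∣p∣+∣q∣ p q (λ x∈p → p#q (there x∈p) ∘ there))) (sym (ℕ.+-suc ∣ p ∣ ∣ q ∣))
∣p∪q∣≡∣p∣+∣q∣ (outside ∷ p) (outside ∷ q) p#q = ∣p∪q∣≡∣p∣+∣q∣ p q (λ x∈p → p#q (there x∈p) ∘ there)

∣p─q∣+∣q∣≡∣p∣ : ∀ (p q : Subset n) → q ⊆ p → ∣ p ─ q ∣ + ∣ q ∣ ≡ ∣ p ∣
∣p─q∣+∣q∣≡∣p∣ [] [] _ = refl
∣p─q∣+∣q∣≡∣p∣ (inside ∷ p) (inside ∷ q) q⊆p =
  trans (ℕ.+-suc ∣ p ─ q ∣ ∣ q ∣) (cong suc (∣p─q∣+∣q∣≡∣p∣ p q (drop-∷-⊆ q⊆p)))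
∣p─q∣+∣q∣≡∣p∣ (outside ∷ p) (inside ∷ q) q⊆p with q⊆p here
... | ()
∣p─q∣+∣q∣≡∣p∣ (inside ∷ p) (outside ∷ q) q⊆p = cong suc (∣p─q∣+∣q∣≡∣p∣ p q (drop-∷-⊆ q⊆p))
∣p─q∣+∣q∣≡∣p∣ (outside ∷ p) (outside ∷ q) q⊆p = ∣p─q∣+∣q∣≡∣p∣ p q (drop-∷-⊆ q⊆p)

∣p-x∣+1≡∣p∣ : x ∈ p → suc ∣ p - x ∣ ≡ ∣ p ∣
∣p-x∣+1≡∣p∣ {x = x} {p} x∈p = begin
  suc ∣ p - x ∣          ≡⟨ ℕ.+-comm 1 ∣ p - x ∣ ⟩
  ∣ p - x ∣ + 1          ≡⟨ cong (∣ p - x ∣ +_) (∣⁅x⁆∣≡1 x) ⟨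
  ∣ p - x ∣ + ∣ ⁅ x ⁆ ∣  ≡⟨ ∣p─q∣+∣q∣≡∣p∣ p ⁅ x ⁆ (⁅x⁆⊆p x∈p) ⟩
  ∣ p ∣                  ∎
  where open ≡-Reasoning

∣p-x∣≡ : ∀ {m} → x ∈ p → ∣ p ∣ ≡ suc m → ∣ p - x ∣ ≡ m
∣p-x∣≡ x∈p ∣p∣≡1+m = ℕ.suc-injective (trans (∣p-x∣+1≡∣p∣ x∈p) ∣p∣≡1+m)

∣p∪⁅x⁆∣≡1+∣p∣ : x ∉ p → ∣ p ∪ ⁅ x ⁆ ∣ ≡ suc ∣ p ∣
∣p∪⁅x⁆∣≡1+∣p∣ {x = x} {p} x∉p = begin
  ∣ p ∪ ⁅ x ⁆ ∣          ≡⟨ ∣p∪q∣≡∣p∣+∣q∣ p ⁅ x ⁆ (∉⇒disjoint⁅⁆ x∉p) ⟩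
  ∣ p ∣ + ∣ ⁅ x ⁆ ∣      ≡⟨ cong (∣ p ∣ +_) (∣⁅x⁆∣≡1 x) ⟩
  ∣ p ∣ + 1              ≡⟨ ℕ.+-comm ∣ p ∣ 1 ⟩
  suc ∣ p ∣              ∎
  where open ≡-Reasoning

⊆∧∣∣≡⇒≡ : p ⊆ q → ∣ p ∣ ≡ ∣ q ∣ → p ≡ q
⊆∧∣∣≡⇒≡ {p = p} {q} p⊆q ∣p∣≡∣q∣ = ⊆-antisym p⊆q q⊆p
  where
  q⊆p : q ⊆ p
  q⊆p {x} x∈q with x ∈? p
  ... | yes x∈p = x∈p
  ... | no x∉p = contradiction ∣p∣≡∣q∣ (ℕ.<⇒≢ (p⊂q⇒∣p∣<∣q∣ (p⊆q , x , x∈q , x∉p)))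

∣p∣≡0⇒x∉p : ∣ p ∣ ≡ 0 → x ∉ p
∣p∣≡0⇒x∉p ∣p∣≡0 x∈p = ℕ.<⇒≢ (ℕ.≤-<-trans z≤n (x∈p⇒∣p-x∣<∣p∣ x∈p)) (sym ∣p∣≡0)

0<∣p∣⇒nonempty : ∀ {n} {p : Subset n} → 0 < ∣ p ∣ → Nonempty p
0<∣p∣⇒nonempty {n = n} {p = p} 0<∣p∣ with nonempty? p
... | yes p≢∅ = p≢∅
... | no p≡∅ = contradiction (trans (cong ∣_∣ (Empty-unique p≡∅)) (∣⊥∣≡0 n)) (ℕ.>⇒≢ 0<∣p∣)

⊈⇒∃∉ : ¬ p ⊆ q → ∃ λ x → x ∈ p × x ∉ q
⊈⇒∃∉ {p = p} {q} p⊈q with any? (λ x → (x ∈? p) ×-dec ¬? (x ∈? q))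
... | yes witness = witness
... | no none = ⊥-elim (p⊈q p⊆q)
  where
  p⊆q : p ⊆ q
  p⊆q {x} x∈p with x ∈? q
  ... | yes x∈q = x∈q
  ... | no x∉q = contradiction (x , x∈p , x∉q) none

∣p∣<∣q∣⇒∃∉ : ∣ p ∣ < ∣ q ∣ → ∃ λ x → x ∈ q × x ∉ p
∣p∣<∣q∣⇒∃∉ ∣p∣<∣q∣ = ⊈⇒∃∉ λ q⊆p → ℕ.<⇒≱ ∣p∣<∣q∣ (p⊆q⇒∣p∣≤∣q∣ q⊆p)

grow-within : ∀ m → p ⊆ r → ∣ p ∣ + m ≤ ∣ r ∣ → ∃ λ q → p ⊆ q × q ⊆ r × ∣ q ∣ ≡ ∣ p ∣ + m
grow-within zero p⊆r _ = _ , id , p⊆r , sym (ℕ.+-identityʳ _)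
grow-within {p = p} {r = r} (suc m) p⊆r ∣p∣+1+m≤∣r∣
  with ∣p∣<∣q∣⇒∃∉ {p = p} (ℕ.<-≤-trans (ℕ.m<m+n ∣ p ∣ (s≤s z≤n)) ∣p∣+1+m≤∣r∣)
... | x , x∈r , x∉p =
  let q , p∪x⊆q , q⊆r , ∣q∣≡ = grow-within m (∪-lub p⊆r (⁅x⁆⊆p x∈r))
                                                (subst (_≤ ∣ r ∣) (sym grown) ∣p∣+1+m≤∣r∣)
  in q , p∪x⊆q ∘ p⊆p∪q ⁅ x ⁆ , q⊆r , trans ∣q∣≡ grown
  where
  grown : ∣ p ∪ ⁅ x ⁆ ∣ + m ≡ ∣ p ∣ + suc m
  grown = trans (cong (_+ m) (∣p∪⁅x⁆∣≡1+∣p∣ {p = p} x∉p)) (sym (ℕ.+-suc ∣ p ∣ m))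

intermediate-subset : ∀ {k} → p ⊆ r → ∣ p ∣ ≤ k → k ≤ ∣ r ∣ → ∃ λ q → p ⊆ q × q ⊆ r × ∣ q ∣ ≡ k
intermediate-subset {p = p} {k = k} p⊆r ∣p∣≤k k≤∣r∣ =
  let q , p⊆q , q⊆r , ∣q∣≡ = grow-within (k ∸ ∣ p ∣) p⊆r (subst (_≤ _) (sym k≡) k≤∣r∣)
  in q , p⊆q , q⊆r , trans ∣q∣≡ k≡
  where
  k≡ : ∣ p ∣ + (k ∸ ∣ p ∣) ≡ k
  k≡ = ℕ.m+[n∸m]≡n ∣p∣≤k

1<∣p∣⇒∃≢ : 1 < ∣ p ∣ → ∃ λ x → ∃ λ y → x ∈ p × y ∈ p × x ≢ y
1<∣p∣⇒∃≢ {p = p} 1<∣p∣ =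
  let x , x∈p = 0<∣p∣⇒nonempty (ℕ.<-trans (s≤s z≤n) 1<∣p∣)
      y , y∈p-x = 0<∣p∣⇒nonempty (ℕ.≤-pred (subst (1 <_) (sym (∣p-x∣+1≡∣p∣ x∈p)) 1<∣p∣))
  in x , y , x∈p , p-x⊆p p x y∈p-x , λ x≡y → x∈p-y⇒x≢y p y∈p-x (sym x≡y)

boundary⊆⇒⊆ : 1 < ∣ p ∣ → (∀ {x} → x ∈ p → p - x ⊆ q) → p ⊆ q
boundary⊆⇒⊆ {p = p} 1<∣p∣ boundary⊆q {z} z∈p =
  let x , y , x∈p , y∈p , x≢y = 1<∣p∣⇒∃≢ {p = p} 1<∣p∣
  in case z ≟ᶠ x of λ where
       (yes z≡x) → boundary⊆q y∈p (x∈p∧x≢y⇒x∈p-y z∈p (x≢y ∘ trans (sym z≡x)))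
       (no z≢x) → boundary⊆q x∈p (x∈p∧x≢y⇒x∈p-y z∈p z≢x)

∣p-a-b∣≡0⇒p⊆⁅a⁆∪⁅b⁆ : ∀ {a b} → ∣ p - a - b ∣ ≡ 0 → p ⊆ ⁅ a ⁆ ∪ ⁅ b ⁆
∣p-a-b∣≡0⇒p⊆⁅a⁆∪⁅b⁆ {a = a} {b} ∣p-a-b∣≡0 {y} y∈p with y ≟ᶠ a | y ≟ᶠ b
... | yes refl | _ = p⊆p∪q ⁅ b ⁆ (x∈⁅x⁆ a)
... | no _ | yes refl = q⊆p∪q ⁅ a ⁆ ⁅ b ⁆ (x∈⁅x⁆ b)
... | no y≢a | no y≢b = contradiction (x∈p∧x≢y⇒x∈p-y (x∈p∧x≢y⇒x∈p-y y∈p y≢a) y≢b) (∣p∣≡0⇒x∉p ∣p-a-b∣≡0)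

∣p∣≡2⇒⊆pair : ∣ p ∣ ≡ 2 → ∃ λ a → ∃ λ b → a ∈ p × b ∈ p × p ⊆ ⁅ a ⁆ ∪ ⁅ b ⁆
∣p∣≡2⇒⊆pair {p = p} ∣p∣≡2 =
  let a , a∈p = 0<∣p∣⇒nonempty (subst (0 <_) (sym ∣p∣≡2) (s≤s z≤n))
      ∣p-a∣≡1 = ∣p-x∣≡ a∈p ∣p∣≡2
      b , b∈p-a = 0<∣p∣⇒nonempty (subst (0 <_) (sym ∣p-a∣≡1) (s≤s z≤n))
  in a , b , a∈p , p-x⊆p p a b∈p-a , ∣p-a-b∣≡0⇒p⊆⁅a⁆∪⁅b⁆ (∣p-x∣≡ b∈p-a ∣p-a∣≡1)

-- Simplicial complexes

Facet-resp-≐ : K ≐ L → Facet K F → Facet L F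
Facet-resp-≐ (K⊆L , L⊆K) (KF , maximal) = K⊆L KF , λ G LG F⊆G → maximal G (L⊆K LG) F⊆G

PureCard-resp-≐ : K ≐ L → PureCard K c → PureCard L c
PureCard-resp-≐ K≐L ((F , facetF) , card) =
  (F , Facet-resp-≐ K≐L facetF) , λ G facetG → card G (Facet-resp-≐ (≐-sym K≐L) facetG)

IsSimplex-resp-≐ : K ≐ L → IsSimplex K → IsSimplex L
IsSimplex-resp-≐ K≐L (S , facetS , unique) =
  S , Facet-resp-≐ K≐L facetS , λ G facetG → unique G (Facet-resp-≐ (≐-sym K≐L) facetG)

del-cong : K ≐ L → del F K ≐ del F L
del-cong (K⊆L , L⊆K) = Product.map₁ K⊆L , Product.map₁ L⊆K

lk-cong : K ≐ L → lk F K ≐ lk F L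
lk-cong (K⊆L , L⊆K) = Product.map K⊆L (Product.map₂ K⊆L) , Product.map L⊆K (Product.map₂ L⊆K)

KDecomposable-resp-≐ : K ≐ L → KDecomposable k K → KDecomposable k L
KDecomposable-resp-≐ K≐L (simplex c pure simplexK) =
  simplex c (PureCard-resp-≐ K≐L pure) (IsSimplex-resp-≐ K≐L simplexK)
KDecomposable-resp-≐ K≐L (shed c pure σ Kσ σ≢∅ ∣σ∣≤ pureDel decLk decDel) =
  shed c (PureCard-resp-≐ K≐L pure) σ (proj₁ K≐L Kσ) σ≢∅ ∣σ∣≤ (PureCard-resp-≐ (del-cong K≐L) pureDel)
    (KDecomposable-resp-≐ (lk-cong K≐L) decLk) (KDecomposable-resp-≐ (del-cong K≐L) decDel)

PureCard-unique : PureCard K c → PureCard K c′ → c ≡ c′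
PureCard-unique ((F , facetF) , card) (_ , card′) = trans (sym (card F facetF)) (card′ F facetF)

PureCard-via : PureCard K c → PureCard K c′ → PureCard L c′ → PureCard L c
PureCard-via pureK pureK′ = subst (PureCard _) (PureCard-unique pureK′ pureK)

KDecomposable⇒pure : KDecomposable k K → ∃ (PureCard K)
KDecomposable⇒pure (simplex c pure _) = c , pure
KDecomposable⇒pure (shed c pure _ _ _ _ _ _ _) = c , pure

shed-≐ : PureCard K c → K σ → Nonempty σ → ∣ σ ∣ ≤ suc k →
         del σ K ≐ D → PureCard D c → KDecomposable k D →
         lk σ K ≐ L → KDecomposable k L → KDecomposable k K
shed-≐ pure Kσ σ≢∅ ∣σ∣≤ del≐ pureD decD lk≐ decL =
  shed _ pure _ Kσ σ≢∅ ∣σ∣≤ (PureCard-resp-≐ (≐-sym del≐) pureD)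
    (KDecomposable-resp-≐ (≐-sym lk≐) decL) (KDecomposable-resp-≐ (≐-sym del≐) decD)

_⊕_ : Cx N → Subset N → Cx N
(K ⊕ F) G = K G ⊎ G ⊆ F

⟨_⟩ : List (Subset N) → Cx N
⟨ Fs ⟩ G = Any (G ⊆_) Fs

⟨∷[]⟩⇒⊆ : ⟨ S ∷ [] ⟩ G → G ⊆ S
⟨∷[]⟩⇒⊆ (here G⊆S) = G⊆S

AllCard : ℕ → List (Subset N) → Set
AllCard c Fs = ∀ {F} → F ∈ˡ Fs → ∣ F ∣ ≡ c

del-isComplex : ∀ F → IsComplex K → IsComplex (del F K)
del-isComplex F isC G H H⊆G (KG , F⊈G) = isC G H H⊆G KG , λ F⊆H → F⊈G (⊆-trans F⊆H H⊆G)

lk-isComplex : ∀ F → IsComplex K → IsComplex (lk F K)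
lk-isComplex F isC G H H⊆G (KG , G∩F≡⊥ , KG∪F) =
  isC G H H⊆G KG , disjoint⇒∩≡⊥ (∩≡⊥⇒disjoint G∩F≡⊥ ∘ H⊆G) , isC _ _ (∪-monoˡ F H⊆G) KG∪F

⊕-isComplex : ∀ F → IsComplex K → IsComplex (K ⊕ F)
⊕-isComplex F isC G H H⊆G = Sum.map (isC G H H⊆G) (⊆-trans H⊆G)

⟨⟩-isComplex : ∀ Fs → IsComplex (⟨_⟩ {N} Fs)
⟨⟩-isComplex Fs G H H⊆G = Any.map (⊆-trans H⊆G)

+⟨⟩-isComplex : ∀ Fs → IsComplex K → IsComplex (K +⟨ Fs ⟩)
+⟨⟩-isComplex Fs isC G H H⊆G = Sum.map (isC G H H⊆G) (⟨⟩-isComplex Fs G H H⊆G)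

del? : ∀ F → Decidable K → Decidable (del F K)
del? F K? G = K? G ×-dec ¬? (F ⊆? G)

lk? : ∀ F → Decidable K → Decidable (lk F K)
lk? F K? G = K? G ×-dec ((G ∩ F) ≟ˢ ⊥ ×-dec K? (G ∪ F))

⊕? : ∀ F → Decidable K → Decidable (K ⊕ F)
⊕? F K? G = K? G ⊎-dec (G ⊆? F)

⟨⟩? : ∀ Fs → Decidable (⟨_⟩ {N} Fs)
⟨⟩? Fs G = Any.any? (G ⊆?_) Fs

+⟨⟩? : ∀ Fs → Decidable K → Decidable (K +⟨ Fs ⟩)
+⟨⟩? Fs K? = K? ∪? ⟨⟩? Fs

+⟨∷⟩ : K +⟨ F ∷ Fs ⟩ ≐ (K ⊕ F) +⟨ Fs ⟩
+⟨∷⟩ = [ inj₁ ∘ inj₁ , [ inj₁ ∘ inj₂ , inj₂ ]′ ∘ Any.toSum ]′ , [ [ inj₁ , inj₂ ∘ here ]′ , inj₂ ∘ there ]′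

+⟨[]⟩ : K +⟨ [] ⟩ ≐ K
+⟨[]⟩ = [ id , (λ ()) ]′ , inj₁

+⟨++⟩ : ∀ {K : Cx N} Fs {Gs} → K +⟨ Fs ++ Gs ⟩ ≐ (K +⟨ Fs ⟩) +⟨ Gs ⟩
+⟨++⟩ Fs = [ inj₁ ∘ inj₁ , Sum.map₁ inj₂ ∘ Any.++⁻ Fs ]′ , [ Sum.map₂ Any.++⁺ˡ , inj₂ ∘ Any.++⁺ʳ Fs ]′

module _ {K : Cx N} (isC : IsComplex K) (K? : Decidable K) where

  private
    grow-to-facet : ∀ m → N ≤ ∣ G ∣ + m → K G → ∃ λ T → Facet K T × G ⊆ T
    grow-to-facet {G = G} m bound KG with any? (λ x → ¬? (x ∈? G) ×-dec K? (G ∪ ⁅ x ⁆))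
    ... | no unextendable = G , (KG , maximal) , id
      where
      maximal : ∀ G′ → K G′ → G ⊆ G′ → G′ ≡ G
      maximal G′ KG′ G⊆G′ = ⊆-antisym G′⊆G G⊆G′
        where
        G′⊆G : G′ ⊆ G
        G′⊆G {y} y∈G′ with y ∈? G
        ... | yes y∈G = y∈G
        ... | no y∉G = contradiction (y , y∉G , isC G′ _ (∪-lub G⊆G′ (⁅x⁆⊆p y∈G′)) KG′) unextendable
    grow-to-facet {G = G} zero bound KG | yes (x , x∉G , KG∪x) =
      contradiction (ℕ.≤-trans 1+∣G∣≤N (subst (N ≤_) (ℕ.+-identityʳ _) bound)) (ℕ.n≮n ∣ G ∣)
      where
      1+∣G∣≤N : suc ∣ G ∣ ≤ N
      1+∣G∣≤N = subst (_≤ N) (∣p∪⁅x⁆∣≡1+∣p∣ x∉G) (∣p∣≤n (G ∪ ⁅ x ⁆))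
    grow-to-facet {G = G} (suc m) bound KG | yes (x , x∉G , KG∪x) =
      let T , facetT , G∪x⊆T = grow-to-facet m (subst (N ≤_) grown bound) KG∪x
      in T , facetT , ⊆-trans (p⊆p∪q ⁅ x ⁆) G∪x⊆T
      where
      grown : ∣ G ∣ + suc m ≡ ∣ G ∪ ⁅ x ⁆ ∣ + m
      grown = trans (ℕ.+-suc ∣ G ∣ m) (cong (_+ m) (sym (∣p∪⁅x⁆∣≡1+∣p∣ x∉G)))

  face⊆facet : K G → ∃ λ T → Facet K T × G ⊆ T
  face⊆facet {G = G} = grow-to-facet N (ℕ.m≤n+m N ∣ G ∣)

  module _ (pure : PureCard K c) where

    face⊆maximal-face : K G → ∃ λ T → K T × G ⊆ T × ∣ T ∣ ≡ c
    face⊆maximal-face KG =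
      let T , facetT , G⊆T = face⊆facet KG in T , proj₁ facetT , G⊆T , proj₂ pure T facetT

    face-card≤ : K G → ∣ G ∣ ≤ c
    face-card≤ KG = let T , _ , G⊆T , ∣T∣≡c = face⊆maximal-face KG in subst (_ ≤_) ∣T∣≡c (p⊆q⇒∣p∣≤∣q∣ G⊆T)

    full-face⇒facet : K G → ∣ G ∣ ≡ c → Facet K G
    full-face⇒facet KG ∣G∣≡c with face⊆facet KG
    ... | T , facetT , G⊆T with ⊆∧∣∣≡⇒≡ G⊆T (trans ∣G∣≡c (sym (proj₂ pure T facetT)))
    ... | refl = facetT

  simplex≐⟨facet⟩ : Facet K S → (∀ G → Facet K G → G ≡ S) → K ≐ ⟨ S ∷ [] ⟩
  simplex≐⟨facet⟩ {S = S} facetS unique = K⊆S , λ { (here G⊆S) → isC S _ G⊆S (proj₁ facetS) }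
    where
    K⊆S : K G → ⟨ S ∷ [] ⟩ G
    K⊆S KG = let T , facetT , G⊆T = face⊆facet KG in here (subst (_ ⊆_) (unique T facetT) G⊆T)

⟨⟩-maximal : AllCard c Fs → ∣ F ∣ ≡ c → ∀ G → ⟨ Fs ⟩ G → F ⊆ G → G ≡ F
⟨⟩-maximal all ∣F∣≡c G ⟨⟩G F⊆G with find ⟨⟩G
... | L , L∈Fs , G⊆L with ⊆∧∣∣≡⇒≡ (⊆-trans F⊆G G⊆L) (trans ∣F∣≡c (sym (all L∈Fs)))
... | refl = ⊆-antisym G⊆L F⊆G

⟨⟩-maximal-card : AllCard c Fs → ⟨ Fs ⟩ G → (∀ Z → ⟨ Fs ⟩ Z → G ⊆ Z → Z ≡ G) → ∣ G ∣ ≡ c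
⟨⟩-maximal-card all ⟨⟩G maximal =
  let L , L∈Fs , G⊆L = find ⟨⟩G in trans (cong ∣_∣ (sym (maximal L (lose L∈Fs ⊆-refl) G⊆L))) (all L∈Fs)

⟨⟩-pure : F ∈ˡ Fs → AllCard c Fs → PureCard ⟨ Fs ⟩ c
⟨⟩-pure F∈Fs all =
  (_ , lose F∈Fs ⊆-refl , ⟨⟩-maximal all (all F∈Fs)) , λ G (⟨⟩G , maximal) → ⟨⟩-maximal-card all ⟨⟩G maximal

+⟨⟩-pure : PureCard K c → AllCard c Fs → PureCard (K +⟨ Fs ⟩) c
+⟨⟩-pure {K = K} {c = c} {Fs = Fs} ((T , KT , maxT) , card) all = (T , inj₁ KT , maxT′) , card′
  where
  maxT′ : ∀ Z → (K +⟨ Fs ⟩) Z → T ⊆ Z → Z ≡ T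
  maxT′ Z (inj₁ KZ) = maxT Z KZ
  maxT′ Z (inj₂ ⟨⟩Z) = ⟨⟩-maximal all (card T (KT , maxT)) Z ⟨⟩Z
  card′ : ∀ G → Facet (K +⟨ Fs ⟩) G → ∣ G ∣ ≡ c
  card′ G (inj₁ KG , maxG) = card G (KG , λ Z KZ → maxG Z (inj₁ KZ))
  card′ G (inj₂ ⟨⟩G , maxG) = ⟨⟩-maximal-card all ⟨⟩G λ Z ⟨⟩Z → maxG Z (inj₂ ⟨⟩Z)

⊕≐+⟨∷[]⟩ : K ⊕ F ≐ K +⟨ F ∷ [] ⟩
⊕≐+⟨∷[]⟩ = Sum.map₂ here , Sum.map₂ λ { (here G⊆F) → G⊆F }

⊕-pure : PureCard K c → ∣ F ∣ ≡ c → PureCard (K ⊕ F) c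
⊕-pure pure ∣F∣≡c = PureCard-resp-≐ (≐-sym ⊕≐+⟨∷[]⟩) (+⟨⟩-pure pure λ { (here refl) → ∣F∣≡c })

⟨simplex⟩-decomposable : ∀ S → KDecomposable k (⟨_⟩ {N} (S ∷ []))
⟨simplex⟩-decomposable S =
  simplex ∣ S ∣ (⟨⟩-pure (here refl) all) (S , (here ⊆-refl , ⟨⟩-maximal all refl) , unique)
  where
  all : AllCard ∣ S ∣ (S ∷ [])
  all (here refl) = refl
  unique : ∀ G → Facet ⟨ S ∷ [] ⟩ G → G ≡ S
  unique G (here G⊆S , maxG) = sym (maxG S (here ⊆-refl) G⊆S)

lk-intro : IsComplex K → K T → G ∪ σ ⊆ T → Disjoint G σ → lk σ K G
lk-intro {σ = σ} isC KT G∪σ⊆T G#σ = isC _ _ (⊆-trans (p⊆p∪q σ) G∪σ⊆T) KT , disjoint⇒∩≡⊥ G#σ , isC _ _ G∪σ⊆T KT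

lk-facet⇒facet : IsComplex K → Facet (lk σ K) T → Facet K (T ∪ σ)
lk-facet⇒facet {K = K} {σ = σ} {T = T} isC ((_ , T∩σ≡⊥ , KT∪σ) , maxT) = KT∪σ , maximal
  where
  maximal : ∀ Z → K Z → T ∪ σ ⊆ Z → Z ≡ T ∪ σ
  maximal Z KZ T∪σ⊆Z = ⊆-antisym (⊆-trans (p⊆p─q∪q Z σ) (∪-monoˡ σ Z─σ⊆T)) T∪σ⊆Z
    where
    Z─σ≡T : Z ─ σ ≡ T
    Z─σ≡T = maxT (Z ─ σ) (lk-intro isC KZ (∪-lub (p─q⊆p Z σ) (⊆-trans (q⊆p∪q T σ) T∪σ⊆Z)) (x∈p─q⇒x∉q Z σ))
                 (p⊆q─r (⊆-trans (p⊆p∪q σ) T∪σ⊆Z) (∩≡⊥⇒disjoint T∩σ≡⊥))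
    Z─σ⊆T : Z ─ σ ⊆ T
    Z─σ⊆T = subst (Z ─ σ ⊆_) Z─σ≡T ⊆-refl

lk-card : ∀ {cL} → IsComplex K → PureCard K c → PureCard (lk σ K) cL → cL + ∣ σ ∣ ≡ c
lk-card {σ = σ} isC pure ((T , facetT) , cardLk) = begin
  _ + ∣ σ ∣        ≡⟨ cong (_+ ∣ σ ∣) (cardLk T facetT) ⟨
  ∣ T ∣ + ∣ σ ∣    ≡⟨ ∣p∪q∣≡∣p∣+∣q∣ T σ (∩≡⊥⇒disjoint (proj₁ (proj₂ (proj₁ facetT)))) ⟨
  ∣ T ∪ σ ∣        ≡⟨ proj₂ pure _ (lk-facet⇒facet isC facetT) ⟩
  _                ∎
  where open ≡-Reasoning

-- Adding a facet

del-non-face : IsComplex K → ¬ K σ → del σ K ≐ K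
del-non-face isC ¬Kσ = proj₁ , λ KG → KG , λ σ⊆G → ¬Kσ (isC _ _ σ⊆G KG)

lk-non-face-⊕ : IsComplex K → ¬ K σ → lk σ K ⊕ F ≐ ⟨ F ∷ [] ⟩
lk-non-face-⊕ {σ = σ} isC ¬Kσ =
  [ (λ (_ , _ , KG∪σ) → contradiction (isC _ _ (q⊆p∪q _ σ) KG∪σ) ¬Kσ) , here ]′ , λ { (here G⊆F) → inj₂ G⊆F }

del-⊕-⊈ : ¬ σ ⊆ F → del σ (K ⊕ F) ≐ del σ K ⊕ F
del-⊕-⊈ σ⊈F =
    (λ { (inj₁ KG , σ⊈G) → inj₁ (KG , σ⊈G) ; (inj₂ G⊆F , _) → inj₂ G⊆F })
  , (λ { (inj₁ (KG , σ⊈G)) → inj₁ KG , σ⊈G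
       ; (inj₂ G⊆F) → inj₂ G⊆F , λ σ⊆G → σ⊈F (⊆-trans σ⊆G G⊆F) })

del-⊕-boundary : IsComplex K → (∀ {x} → x ∈ σ → K (F - x)) → del σ (K ⊕ F) ≐ del σ K
del-⊕-boundary {K = K} {σ = σ} {F = F} isC boundary = to , λ (KG , σ⊈G) → inj₁ KG , σ⊈G
  where
  to : del σ (K ⊕ F) G → del σ K G
  to (inj₁ KG , σ⊈G) = KG , σ⊈G
  to (inj₂ G⊆F , σ⊈G) = let x , x∈σ , x∉G = ⊈⇒∃∉ σ⊈G in isC _ _ (p⊆q-x G⊆F x∉G) (boundary x∈σ) , σ⊈G

lk-⊕-⊈ : IsComplex K → ¬ σ ⊆ F → lk σ (K ⊕ F) ≐ lk σ K
lk-⊕-⊈ {K = K} {σ = σ} {F = F} isC σ⊈F = to , λ (KG , G∩σ≡⊥ , KG∪σ) → inj₁ KG , G∩σ≡⊥ , inj₁ KG∪σ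
  where
  to : lk σ (K ⊕ F) G → lk σ K G
  to (_ , G∩σ≡⊥ , inj₁ KG∪σ) = isC _ _ (p⊆p∪q σ) KG∪σ , G∩σ≡⊥ , KG∪σ
  to (_ , _ , inj₂ G∪σ⊆F) = ⊥-elim (σ⊈F (⊆-trans (q⊆p∪q _ σ) G∪σ⊆F))

lk-⊕-⊆ : IsComplex K → σ ⊆ F → lk σ (K ⊕ F) ≐ lk σ K ⊕ (F ─ σ)
lk-⊕-⊆ {K = K} {σ = σ} {F = F} isC σ⊆F = to , from
  where
  to : lk σ (K ⊕ F) G → (lk σ K ⊕ (F ─ σ)) G
  to (_ , G∩σ≡⊥ , inj₁ KG∪σ) = inj₁ (isC _ _ (p⊆p∪q σ) KG∪σ , G∩σ≡⊥ , KG∪σ)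
  to (_ , G∩σ≡⊥ , inj₂ G∪σ⊆F) = inj₂ (p⊆q─r (⊆-trans (p⊆p∪q σ) G∪σ⊆F) (∩≡⊥⇒disjoint G∩σ≡⊥))
  from : (lk σ K ⊕ (F ─ σ)) G → lk σ (K ⊕ F) G
  from (inj₁ (KG , G∩σ≡⊥ , KG∪σ)) = inj₁ KG , G∩σ≡⊥ , inj₁ KG∪σ
  from (inj₂ G⊆F─σ) = lk-intro (⊕-isComplex F isC) (inj₂ ⊆-refl) (∪-lub (⊆-trans G⊆F─σ (p─q⊆p F σ)) σ⊆F)
                                (x∈p─q⇒x∉q F σ ∘ G⊆F─σ)

-- σ is shed: its deletion is K and its link is the simplex F ─ σ.
⊕-decomposable-shedding-new-face : IsComplex K → PureCard K c → KDecomposable k K → ∣ F ∣ ≡ c →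
  σ ⊆ F → Nonempty σ → ∣ σ ∣ ≤ suc k → ¬ K σ → (∀ {x} → x ∈ σ → K (F - x)) → KDecomposable k (K ⊕ F)
⊕-decomposable-shedding-new-face {F = F} {σ = σ} isC pure decK ∣F∣≡c σ⊆F σ≢∅ ∣σ∣≤ ¬Kσ boundary =
  shed-≐ (⊕-pure pure ∣F∣≡c) (inj₂ σ⊆F) σ≢∅ ∣σ∣≤
    (≐-trans (del-⊕-boundary isC boundary) (del-non-face isC ¬Kσ)) pure decK
    (≐-trans (lk-⊕-⊆ isC σ⊆F) (lk-non-face-⊕ isC ¬Kσ)) (⟨simplex⟩-decomposable (F ─ σ))

Fillable : Cx N → ℕ → Subset N → Set
Fillable K c F = ∣ F ∣ ≡ c × ¬ K F × (∀ {x} → x ∈ F → K (F - x))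

Fillable-⊕ : ∣ F ∣ ≡ c → G ≢ F → Fillable K c G → Fillable (K ⊕ F) c G
Fillable-⊕ ∣F∣≡c G≢F (∣G∣≡c , ¬KG , boundary) =
  ∣G∣≡c , [ ¬KG , (λ G⊆F → G≢F (⊆∧∣∣≡⇒≡ G⊆F (trans ∣G∣≡c (sym ∣F∣≡c)))) ]′ , inj₁ ∘ boundary

Fillable-del : ¬ σ ⊆ F → Fillable K c F → Fillable (del σ K) c F
Fillable-del {F = F} σ⊈F (∣F∣≡c , ¬KF , boundary) =
  ∣F∣≡c , ¬KF ∘ proj₁ , λ {x} x∈F → boundary x∈F , λ σ⊆F-x → σ⊈F (⊆-trans σ⊆F-x (p-x⊆p F x))

Fillable-lk : ∀ {cL} → IsComplex K → σ ⊆ F → cL + ∣ σ ∣ ≡ c → Fillable K c F → Fillable (lk σ K) cL (F ─ σ)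
Fillable-lk {σ = σ} {F = F} isC σ⊆F cL+∣σ∣≡c (∣F∣≡c , ¬KF , boundary) =
    ℕ.+-cancelʳ-≡ ∣ σ ∣ _ _ (trans (∣p─q∣+∣q∣≡∣p∣ F σ σ⊆F) (trans ∣F∣≡c (sym cL+∣σ∣≡c)))
  , (λ (_ , _ , KF─σ∪σ) → ¬KF (isC _ F (p⊆p─q∪q F σ) KF─σ∪σ))
  , λ {y} y∈F─σ → lk-intro isC (boundary (p─q⊆p F σ y∈F─σ))
                    (∪-lub (p⊆q⇒p-x⊆q-x (p─q⊆p F σ)) (p⊆q-x σ⊆F (x∈p─q⇒x∉q F σ y∈F─σ)))
                    (x∈p─q⇒x∉q F σ ∘ p-x⊆p (F ─ σ) y)

-- A shedding face σ of K still sheds K ⊕ F: F enters the link when σ ⊆ F and the deletion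
-- otherwise. When K is a simplex, F has at most one vertex and is shed itself.
⊕-decomposable : IsComplex K → Decidable K → PureCard K c → KDecomposable k K → Fillable K c F →
                 KDecomposable k (K ⊕ F)
⊕-decomposable {K = K} {F = F} isC K? pure decK@(simplex _ _ (S , facetS , unique)) (∣F∣≡c , ¬KF , boundary) =
  ⊕-decomposable-shedding-new-face isC pure decK ∣F∣≡c ⊆-refl F≢∅ (ℕ.≤-trans ∣F∣≤1 (s≤s z≤n)) ¬KF boundary
  where
  K⊆S : K G → ⟨ S ∷ [] ⟩ G
  K⊆S = proj₁ (simplex≐⟨facet⟩ isC K? facetS unique)
  F⊈S : ¬ F ⊆ S
  F⊈S F⊆S = ¬KF (isC S F F⊆S (proj₁ facetS))
  F≢∅ : Nonempty F
  F≢∅ with nonempty? F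
  ... | yes F≢∅ = F≢∅
  ... | no F≡∅ = ⊥-elim (F⊈S (subst (_⊆ S) (sym (Empty-unique F≡∅)) ⊥⊆))
  ∣F∣≤1 : ∣ F ∣ ≤ 1
  ∣F∣≤1 = ℕ.≮⇒≥ λ 1<∣F∣ → F⊈S (boundary⊆⇒⊆ 1<∣F∣ λ x∈F → ⟨∷[]⟩⇒⊆ (K⊆S (boundary x∈F)))
⊕-decomposable {K = K} {c = c} {F = F} isC K? pure (shed _ pure′ σ Kσ σ≢∅ ∣σ∣≤ pureDel decLk decDel) fillable
  with σ ⊆? F
... | no σ⊈F =
  shed-≐ (⊕-pure pure (proj₁ fillable)) (inj₁ Kσ) σ≢∅ ∣σ∣≤
    (del-⊕-⊈ σ⊈F) (⊕-pure pureDel′ (proj₁ fillable))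
    (⊕-decomposable (del-isComplex σ isC) (del? σ K?) pureDel′ decDel (Fillable-del {K = K} σ⊈F fillable))
    (lk-⊕-⊈ isC σ⊈F) decLk
  where
  pureDel′ : PureCard (del σ K) c
  pureDel′ = PureCard-via pure pure′ pureDel
... | yes σ⊆F =
  shed-≐ (⊕-pure pure (proj₁ fillable)) (inj₁ Kσ) σ≢∅ ∣σ∣≤
    (del-⊕-boundary isC (proj₂ (proj₂ fillable) ∘ σ⊆F)) pureDel′ decDel
    (lk-⊕-⊆ isC σ⊆F)
    (⊕-decomposable (lk-isComplex σ isC) (lk? σ K?) pureLk decLk
                    (Fillable-lk isC σ⊆F (lk-card isC pure pureLk) fillable))
  where
  pureDel′ : PureCard (del σ K) c
  pureDel′ = PureCard-via pure pure′ pureDel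
  pureLk : PureCard (lk σ K) (proj₁ (KDecomposable⇒pure decLk))
  pureLk = proj₂ (KDecomposable⇒pure decLk)

-- Cones

-- The cone with apex h over M, provided h is not a vertex of M (Avoids h M).
cone : Fin N → Cx N → Cx N
cone h M G = M (G - h)

Avoids : Fin N → Cx N → Set
Avoids h M = ∀ {G} → M G → h ∉ G

cone-isComplex : ∀ h → IsComplex M → IsComplex (cone h M)
cone-isComplex h isM G H H⊆G = isM _ _ (p⊆q⇒p-x⊆q-x H⊆G)

cone? : ∀ h → Decidable M → Decidable (cone h M)
cone? h M? G = M? (G - h)

cone-cong : M ≐ M′ → cone h M ≐ cone h M′
cone-cong (M⊆M′ , M′⊆M) = M⊆M′ , M′⊆M

cone-⟨⟩ : ∀ (h : Fin N) Fs → cone h ⟨ Fs ⟩ ≐ ⟨ map (_∪ ⁅ h ⁆) Fs ⟩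
cone-⟨⟩ h Fs = to , from
  where
  to : cone h ⟨ Fs ⟩ G → ⟨ map (_∪ ⁅ h ⁆) Fs ⟩ G
  to {G} ⟨⟩G-h = let F , F∈Fs , G-h⊆F = find ⟨⟩G-h
                 in lose (∈-map⁺ (_∪ ⁅ h ⁆) F∈Fs) (⊆-trans (p⊆p-x∪⁅x⁆ G h) (∪-monoˡ ⁅ h ⁆ G-h⊆F))
  from : ⟨ map (_∪ ⁅ h ⁆) Fs ⟩ G → cone h ⟨ Fs ⟩ G
  from {G} ⟨⟩G with find ⟨⟩G
  ... | _ , F∪h∈ , G⊆F∪h with ∈-map⁻ (_∪ ⁅ h ⁆) F∪h∈
  ... | F , F∈Fs , refl = lose F∈Fs (⊆-trans (p⊆q⇒p-x⊆q-x G⊆F∪h) (p∪⁅x⁆-x⊆p F h))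

module _ {M : Cx N} {h : Fin N} (isM : IsComplex M) (avoids : Avoids h M) where

  cone-facet⁺ : Facet M T → Facet (cone h M) (T ∪ ⁅ h ⁆)
  cone-facet⁺ {T = T} (MT , maxT) = isM _ _ (p∪⁅x⁆-x⊆p T h) MT , maximal
    where
    maximal : ∀ Z → cone h M Z → T ∪ ⁅ h ⁆ ⊆ Z → Z ≡ T ∪ ⁅ h ⁆
    maximal Z MZ-h T∪h⊆Z = ⊆-antisym (subst (λ X → Z ⊆ X ∪ ⁅ h ⁆) Z-h≡T (p⊆p-x∪⁅x⁆ Z h)) T∪h⊆Z
      where
      Z-h≡T : Z - h ≡ T
      Z-h≡T = maxT (Z - h) MZ-h (p⊆q-x (⊆-trans (p⊆p∪q ⁅ h ⁆) T∪h⊆Z) (avoids MT))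

  cone-facet⁻ : Facet (cone h M) T → h ∈ T × Facet M (T - h)
  cone-facet⁻ {T = T} (MT-h , maxT) = h∈T , MT-h , maximal
    where
    T∪h≡T : T ∪ ⁅ h ⁆ ≡ T
    T∪h≡T = maxT (T ∪ ⁅ h ⁆) (isM _ _ (p⊆q-x (p∪⁅x⁆-x⊆p T h) (x∉p-x (T ∪ ⁅ h ⁆) h)) MT-h) (p⊆p∪q ⁅ h ⁆)
    h∈T : h ∈ T
    h∈T = subst (h ∈_) T∪h≡T (q⊆p∪q T ⁅ h ⁆ (x∈⁅x⁆ h))
    maximal : ∀ Z → M Z → T - h ⊆ Z → Z ≡ T - h
    maximal Z MZ T-h⊆Z = ⊆-antisym (p⊆q-x Z⊆T (avoids MZ)) T-h⊆Z
      where
      Z∪h≡T : Z ∪ ⁅ h ⁆ ≡ T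
      Z∪h≡T = maxT (Z ∪ ⁅ h ⁆) (isM _ _ (p∪⁅x⁆-x⊆p Z h) MZ) (⊆-trans (p⊆p-x∪⁅x⁆ T h) (∪-monoˡ ⁅ h ⁆ T-h⊆Z))
      Z⊆T : Z ⊆ T
      Z⊆T = subst (Z ⊆_) Z∪h≡T (p⊆p∪q ⁅ h ⁆)

  cone-pure : PureCard M c → PureCard (cone h M) (suc c)
  cone-pure ((T , facetT) , card) = (T ∪ ⁅ h ⁆ , cone-facet⁺ facetT) , λ G facetG →
    let h∈G , facetG-h = cone-facet⁻ facetG in trans (sym (∣p-x∣+1≡∣p∣ h∈G)) (cong suc (card _ facetG-h))

del-cone : h ∉ σ → del σ (cone h M) ≐ cone h (del σ M)
del-cone h∉σ = Product.map₂ (λ σ⊈G σ⊆G-h → σ⊈G (⊆-trans σ⊆G-h (p-x⊆p _ _)))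
              , Product.map₂ (λ σ⊈G-h σ⊆G → σ⊈G-h (p⊆q-x σ⊆G h∉σ))

lk-cone : IsComplex M → h ∉ σ → lk σ (cone h M) ≐ cone h (lk σ M)
lk-cone {M = M} {h = h} {σ = σ} isM h∉σ = to , from
  where
  to : lk σ (cone h M) G → cone h (lk σ M) G
  to {G} (MG-h , G∩σ≡⊥ , MG∪σ-h) =
    MG-h , disjoint⇒∩≡⊥ (∩≡⊥⇒disjoint G∩σ≡⊥ ∘ p-x⊆p G h) , isM _ _ (p-x∪q⊆p∪q-x G σ h∉σ) MG∪σ-h
  from : cone h (lk σ M) G → lk σ (cone h M) G
  from {G} (MG-h , G-h∩σ≡⊥ , MG-h∪σ) = MG-h , disjoint⇒∩≡⊥ G#σ , isM _ _ (p∪q-x⊆p-x∪q G σ h) MG-h∪σ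
    where
    G#σ : Disjoint G σ
    G#σ {y} y∈G y∈σ = ∩≡⊥⇒disjoint G-h∩σ≡⊥ (x∈p∧x≢y⇒x∈p-y y∈G λ { refl → h∉σ y∈σ }) y∈σ

cone-decomposable : IsComplex M → Decidable M → Avoids h M → KDecomposable k M → KDecomposable k (cone h M)
cone-decomposable {h = h} isM M? avoids (simplex _ _ (S , facetS , unique)) =
  KDecomposable-resp-≐
    (≐-sym (≐-trans (cone-cong (simplex≐⟨facet⟩ isM M? facetS unique)) (cone-⟨⟩ h (S ∷ []))))
    (⟨simplex⟩-decomposable (S ∪ ⁅ h ⁆))
cone-decomposable {M = M} {h = h} isM M? avoids (shed _ pure σ Mσ σ≢∅ ∣σ∣≤ pureDel decLk decDel) =
  shed-≐ (cone-pure isM avoids pure) (isM _ _ (p-x⊆p σ h) Mσ) σ≢∅ ∣σ∣≤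
    (del-cone {M = M} (avoids Mσ)) (cone-pure (del-isComplex σ isM) avoidsDel pureDel)
    (cone-decomposable (del-isComplex σ isM) (del? σ M?) avoidsDel decDel)
    (lk-cone isM (avoids Mσ)) (cone-decomposable (lk-isComplex σ isM) (lk? σ M?) avoidsLk decLk)
  where
  avoidsDel : Avoids h (del σ M)
  avoidsDel (MG , _) = avoids MG
  avoidsLk : Avoids h (lk σ M)
  avoidsLk (MG , _) = avoids MG

-- Skeleta

-- skel c ⟨ S ∷ [] ⟩ is the boundary of a simplex S with c vertices.
skel : ℕ → Cx N → Cx N
skel c K G = K G × ∣ G ∣ < c

skel-isComplex : ∀ c → IsComplex K → IsComplex (skel c K)
skel-isComplex c isC G H H⊆G (KG , ∣G∣<c) = isC G H H⊆G KG , ℕ.≤-<-trans (p⊆q⇒∣p∣≤∣q∣ H⊆G) ∣G∣<c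

skel? : ∀ c → Decidable K → Decidable (skel c K)
skel? c K? G = K? G ×-dec (suc ∣ G ∣ ≤? c)

skel-cong : K ≐ L → skel c K ≐ skel c L
skel-cong (K⊆L , L⊆K) = Product.map₁ K⊆L , Product.map₁ L⊆K

del-skel : del σ (skel c K) ≐ skel c (del σ K)
del-skel = (λ ((KG , ∣G∣<c) , σ⊈G) → (KG , σ⊈G) , ∣G∣<c) , (λ ((KG , σ⊈G) , ∣G∣<c) → (KG , ∣G∣<c) , σ⊈G)

lk-skel : ∀ {cL} → cL + ∣ σ ∣ ≡ c → lk σ (skel c K) ≐ skel cL (lk σ K)
lk-skel {σ = σ} {c = c} {K = K} {cL = cL} cL+∣σ∣≡c = to , from
  where
  to : lk σ (skel c K) G → skel cL (lk σ K) G
  to {G} ((KG , _) , G∩σ≡⊥ , (KG∪σ , ∣G∪σ∣<c)) =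
    (KG , G∩σ≡⊥ , KG∪σ) ,
    ℕ.+-cancelʳ-< ∣ σ ∣ ∣ G ∣ cL (subst₂ _<_ (∣p∪q∣≡∣p∣+∣q∣ G σ (∩≡⊥⇒disjoint G∩σ≡⊥)) (sym cL+∣σ∣≡c) ∣G∪σ∣<c)
  from : skel cL (lk σ K) G → lk σ (skel c K) G
  from {G} ((KG , G∩σ≡⊥ , KG∪σ) , ∣G∣<cL) =
    (KG , ℕ.<-≤-trans ∣G∣<cL (subst (cL ≤_) cL+∣σ∣≡c (ℕ.m≤m+n cL ∣ σ ∣))) , G∩σ≡⊥ ,
    (KG∪σ , subst₂ _<_ (sym (∣p∪q∣≡∣p∣+∣q∣ G σ (∩≡⊥⇒disjoint G∩σ≡⊥))) cL+∣σ∣≡c (ℕ.+-monoˡ-< ∣ σ ∣ ∣G∣<cL))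

module _ {K : Cx N} (isC : IsComplex K) (K? : Decidable K) (pure : PureCard K (suc c)) where

  skel-face⊆maximal-face : skel (suc c) K G → ∃ λ R → skel (suc c) K R × G ⊆ R × ∣ R ∣ ≡ c
  skel-face⊆maximal-face {G = G} (KG , ∣G∣<1+c) with face⊆maximal-face isC K? pure KG
  ... | T , KT , G⊆T , ∣T∣≡1+c with ∣p∣<∣q∣⇒∃∉ {p = G} {q = T} (subst (∣ G ∣ <_) (sym ∣T∣≡1+c) ∣G∣<1+c)
  ... | y , y∈T , y∉G =
    T - y , (isC _ _ (p-x⊆p T y) KT , subst (_< suc c) (sym ∣T-y∣≡c) (ℕ.n<1+n c)) , p⊆q-x G⊆T y∉G , ∣T-y∣≡c
    where
    ∣T-y∣≡c : ∣ T - y ∣ ≡ c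
    ∣T-y∣≡c = ∣p-x∣≡ {p = T} y∈T ∣T∣≡1+c

  skel-maximal-face⇒facet : skel (suc c) K R → ∣ R ∣ ≡ c → Facet (skel (suc c) K) R
  skel-maximal-face⇒facet skelR ∣R∣≡c = skelR , λ Z (_ , ∣Z∣<1+c) R⊆Z →
    sym (⊆∧∣∣≡⇒≡ R⊆Z (ℕ.≤-antisym (p⊆q⇒∣p∣≤∣q∣ R⊆Z) (subst (∣ Z ∣ ≤_) (sym ∣R∣≡c) (ℕ.≤-pred ∣Z∣<1+c))))

  skel-pure : PureCard (skel (suc c) K) c
  skel-pure =
    let R , skelR , _ , ∣R∣≡c = skel-face⊆maximal-face skel⊥ in (R , skel-maximal-face⇒facet skelR ∣R∣≡c) , card
    where
    skel⊥ : skel (suc c) K ⊥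
    skel⊥ = let (T₀ , (KT₀ , _)) , _ = pure in isC T₀ ⊥ ⊥⊆ KT₀ , subst (_< suc c) (sym (∣⊥∣≡0 N)) (s≤s z≤n)
    card : ∀ G → Facet (skel (suc c) K) G → ∣ G ∣ ≡ c
    card G (skelG , maxG) = let R′ , skelR′ , G⊆R′ , ∣R′∣≡c = skel-face⊆maximal-face skelG
                            in trans (cong ∣_∣ (sym (maxG R′ skelR′ G⊆R′))) ∣R′∣≡c

lk-⟨simplex⟩ : x ∈ S → lk ⁅ x ⁆ ⟨ S ∷ [] ⟩ ≐ ⟨ (S - x) ∷ [] ⟩
lk-⟨simplex⟩ {x = x} {S = S} x∈S = to , from
  where
  to : lk ⁅ x ⁆ ⟨ S ∷ [] ⟩ G → ⟨ (S - x) ∷ [] ⟩ G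
  to (here G⊆S , G∩x≡⊥ , _) = here (p⊆q-x G⊆S λ x∈G → ∩≡⊥⇒disjoint G∩x≡⊥ x∈G (x∈⁅x⁆ x))
  from : ⟨ (S - x) ∷ [] ⟩ G → lk ⁅ x ⁆ ⟨ S ∷ [] ⟩ G
  from (here G⊆S-x) =
    lk-intro (⟨⟩-isComplex (S ∷ [])) (here ⊆-refl) (∪-lub (⊆-trans G⊆S-x (p-x⊆p S x)) (⁅x⁆⊆p x∈S))
      λ y∈G y∈⁅x⁆ → x∈p-y⇒x≢y S (G⊆S-x y∈G) (x∈⁅y⁆⇒x≡y x y∈⁅x⁆)

del-skel-⟨simplex⟩ : ∀ {m} → x ∈ S → ∣ S ∣ ≡ suc (suc m) →
                     del ⁅ x ⁆ (skel (suc (suc m)) ⟨ S ∷ [] ⟩) ≐ ⟨ (S - x) ∷ [] ⟩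
del-skel-⟨simplex⟩ {x = x} {S = S} {m = m} x∈S ∣S∣≡2+m = to , from
  where
  to : del ⁅ x ⁆ (skel (suc (suc m)) ⟨ S ∷ [] ⟩) G → ⟨ (S - x) ∷ [] ⟩ G
  to ((here G⊆S , _) , x⊈G) = here (p⊆q-x G⊆S (x⊈G ∘ ⁅x⁆⊆p))
  from : ⟨ (S - x) ∷ [] ⟩ G → del ⁅ x ⁆ (skel (suc (suc m)) ⟨ S ∷ [] ⟩) G
  from (here G⊆S-x) =
      (here (⊆-trans G⊆S-x (p-x⊆p S x)) , s≤s (subst (_ ≤_) (∣p-x∣≡ {p = S} x∈S ∣S∣≡2+m) (p⊆q⇒∣p∣≤∣q∣ G⊆S-x)))
    , λ x⊆G → x∉p-x S x (G⊆S-x (x⊆G (x∈⁅x⁆ x)))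

skel-⟨simplex⟩-decomposable : ∀ {N} {S : Subset N} m → ∣ S ∣ ≡ suc m →
                              KDecomposable k (skel (suc m) ⟨ S ∷ [] ⟩)
skel-⟨simplex⟩-decomposable {N = N} {S = S} zero _ =
  KDecomposable-resp-≐ (≐-sym skel≐⟨∅⟩) (⟨simplex⟩-decomposable ⊥)
  where
  skel≐⟨∅⟩ : skel 1 ⟨ S ∷ [] ⟩ ≐ ⟨ ⊥ ∷ [] ⟩
  skel≐⟨∅⟩ = (λ (_ , ∣G∣<1) → here λ x∈G → contradiction x∈G (∣p∣≡0⇒x∉p (ℕ.n<1⇒n≡0 ∣G∣<1)))
           , λ { {G} (here G⊆⊥) → here (⊆-trans G⊆⊥ ⊥⊆) , s≤s (subst (∣ G ∣ ≤_) (∣⊥∣≡0 N) (p⊆q⇒∣p∣≤∣q∣ G⊆⊥)) }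
skel-⟨simplex⟩-decomposable {S = S} (suc m) ∣S∣≡2+m =
  let x , x∈S = 0<∣p∣⇒nonempty (subst (0 <_) (sym ∣S∣≡2+m) (s≤s z≤n))
      ∣S-x∣≡1+m = ∣p-x∣≡ {p = S} x∈S ∣S∣≡2+m
  in shed-≐ (skel-pure (⟨⟩-isComplex (S ∷ [])) (⟨⟩? (S ∷ [])) pureS)
       (here (⁅x⁆⊆p x∈S) , subst (_< 2 + m) (sym (∣⁅x⁆∣≡1 x)) (s≤s (s≤s z≤n))) (x , x∈⁅x⁆ x)
       (subst (_≤ suc _) (sym (∣⁅x⁆∣≡1 x)) (s≤s z≤n))
       (del-skel-⟨simplex⟩ x∈S ∣S∣≡2+m) (⟨⟩-pure (here refl) λ { (here refl) → ∣S-x∣≡1+m ; (there ()) })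
       (⟨simplex⟩-decomposable (S - x))
       (≐-trans (lk-skel (trans (cong (suc m +_) (∣⁅x⁆∣≡1 x)) (ℕ.+-comm (suc m) 1)))
                (skel-cong (lk-⟨simplex⟩ x∈S)))
       (skel-⟨simplex⟩-decomposable m ∣S-x∣≡1+m)
  where
  pureS : PureCard ⟨ S ∷ [] ⟩ (suc (suc m))
  pureS = ⟨⟩-pure (here refl) λ { (here refl) → ∣S∣≡2+m ; (there ()) }

skel-decomposable : IsComplex K → Decidable K → PureCard K (suc c) → KDecomposable k K →
                    KDecomposable k (skel (suc c) K)
skel-decomposable {c = c} isC K? pure (simplex _ _ (S , facetS , unique)) =
  KDecomposable-resp-≐ (skel-cong (≐-sym (simplex≐⟨facet⟩ isC K? facetS unique)))
    (skel-⟨simplex⟩-decomposable c (proj₂ pure S facetS))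
skel-decomposable {K = K} {c = c} isC K? pure (shed _ pure′ σ Kσ σ≢∅ ∣σ∣≤ pureDel decLk decDel)
  with KDecomposable⇒pure decLk
-- σ is a facet of K, so no face of the skeleton contains it.
... | zero , pureLk = KDecomposable-resp-≐ (≐-sym skel≐skel-del)
                        (skel-decomposable (del-isComplex σ isC) (del? σ K?) (PureCard-via pure pure′ pureDel) decDel)
  where
  skel≐skel-del : skel (suc c) K ≐ skel (suc c) (del σ K)
  skel≐skel-del =
      (λ {G} (KG , ∣G∣<1+c) →
         (KG , λ σ⊆G → ℕ.<⇒≱ ∣G∣<1+c (subst (_≤ ∣ G ∣) (lk-card isC pure pureLk) (p⊆q⇒∣p∣≤∣q∣ σ⊆G))) , ∣G∣<1+c)
    , (λ ((KG , _) , ∣G∣<1+c) → KG , ∣G∣<1+c)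
... | suc cL , pureLk =
  shed-≐ (skel-pure isC K? pure) (Kσ , subst (∣ σ ∣ <_) cL+∣σ∣≡1+c (ℕ.m<n+m ∣ σ ∣ (s≤s z≤n))) σ≢∅ ∣σ∣≤
    del-skel (skel-pure (del-isComplex σ isC) (del? σ K?) pureDel′)
    (skel-decomposable (del-isComplex σ isC) (del? σ K?) pureDel′ decDel)
    (lk-skel cL+∣σ∣≡1+c) (skel-decomposable (lk-isComplex σ isC) (lk? σ K?) pureLk decLk)
  where
  pureDel′ : PureCard (del σ K) (suc c)
  pureDel′ = PureCard-via pure pure′ pureDel
  cL+∣σ∣≡1+c : suc cL + ∣ σ ∣ ≡ suc c
  cL+∣σ∣≡1+c = lk-card isC pure pureLk

-- Orderings of new facets

split-++ : ∀ {A : Set} (xs ys as bs : List A) → xs ++ ys ≡ as ++ bs →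
           (∃ λ zs → xs ++ zs ≡ as) ⊎ (∃ λ ws → xs ≡ as ++ ws × ws ++ ys ≡ bs)
split-++ xs ys [] bs eq = inj₂ (xs , refl , eq)
split-++ [] ys (a ∷ as) bs eq = inj₁ (a ∷ as , refl)
split-++ (x ∷ xs) ys (a ∷ as) bs eq with List.∷-injective eq
... | refl , eq′ =
  Sum.map (Product.map₂ (cong (x ∷_))) (Product.map₂ (Product.map₁ (cong (x ∷_)))) (split-++ xs ys as bs eq′)

split-++-map : ∀ {A B : Set} (f : A → B) (ws ys : List B) (as : List A) → ws ++ ys ≡ map f as →
               ∃ λ ws′ → ∃ λ ys′ → as ≡ ws′ ++ ys′ × ws ≡ map f ws′
split-++-map f [] ys as eq = [] , as , refl , refl
split-++-map f (w ∷ ws) ys (a ∷ as) eq with List.∷-injective eq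
... | refl , eq′ =
  let ws′ , ys′ , as≡ , ws≡ = split-++-map f ws ys as eq′ in a ∷ ws′ , ys′ , cong (a ∷_) as≡ , cong (f a ∷_) ws≡

Unique-map⁺ : ∀ {A B : Set} {f : A → B} {xs : List A} → (∀ {x y} → x ∈ˡ xs → y ∈ˡ xs → f x ≡ f y → x ≡ y) →
              Unique xs → Unique (map f xs)
Unique-map⁺ {xs = []} f-inj [] = []
Unique-map⁺ {xs = x ∷ xs} f-inj (x∉xs ∷ unique) =
  All.map⁺ (All.tabulate λ y∈xs fx≡fy → All.lookup x∉xs y∈xs (f-inj (here refl) (there y∈xs) fx≡fy))
  ∷ Unique-map⁺ (λ x∈ y∈ → f-inj (there x∈) (there y∈)) unique

module _ {A : Set} {P Q : A → Set} (P? : Decidable P) (Q? : Decidable Q) (Q⇒P : ∀ {x} → Q x → P x) where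

  length-filter-mono : ∀ xs → length (filter Q? xs) ≤ length (filter P? xs)
  length-filter-mono [] = z≤n
  length-filter-mono (x ∷ xs) with P? x | Q? x
  ... | yes _ | yes _ = s≤s (length-filter-mono xs)
  ... | yes _ | no _ = ℕ.m≤n⇒m≤1+n (length-filter-mono xs)
  ... | no ¬Px | yes Qx = ⊥-elim (¬Px (Q⇒P Qx))
  ... | no _ | no _ = length-filter-mono xs

  length-filter-strict : ∀ {x xs} → x ∈ˡ xs → P x → ¬ Q x → length (filter Q? xs) < length (filter P? xs)
  length-filter-strict {xs = y ∷ xs} (here refl) Py ¬Qy with P? y | Q? y
  ... | yes _ | no _ = s≤s (length-filter-mono xs)
  ... | yes _ | yes Qy = ⊥-elim (¬Qy Qy)
  ... | no ¬Py | _ = ⊥-elim (¬Py Py)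
  length-filter-strict {xs = y ∷ xs} (there x∈) Px ¬Qx with P? y | Q? y
  ... | yes _ | yes _ = s≤s (length-filter-strict x∈ Px ¬Qx)
  ... | yes _ | no _ = ℕ.m<n⇒m<1+n (length-filter-strict x∈ Px ¬Qx)
  ... | no ¬Py | yes Qy = ⊥-elim (¬Py (Q⇒P Qy))
  ... | no _ | no _ = length-filter-strict x∈ Px ¬Qx

allSubsets : ∀ n → List (Subset n)
allSubsets zero = [] ∷ []
allSubsets (suc n) = map (outside ∷_) (allSubsets n) ++ map (inside ∷_) (allSubsets n)

∈-allSubsets : ∀ {n} (p : Subset n) → p ∈ˡ allSubsets n
∈-allSubsets [] = here refl
∈-allSubsets {suc n} (outside ∷ p) = ∈-++⁺ˡ (∈-map⁺ (outside ∷_) (∈-allSubsets p))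
∈-allSubsets {suc n} (inside ∷ p) =
  ∈-++⁺ʳ (map (outside ∷_) (allSubsets n)) (∈-map⁺ (inside ∷_) (∈-allSubsets p))

allSubsets-unique : ∀ n → Unique (allSubsets n)
allSubsets-unique zero = [] ∷ []
allSubsets-unique (suc n) =
  Unique.++⁺ (Unique.map⁺ (proj₂ ∘ Vec.∷-injective) (allSubsets-unique n))
             (Unique.map⁺ (proj₂ ∘ Vec.∷-injective) (allSubsets-unique n)) disjoint
  where
  disjoint : ∀ {p} → ¬ (p ∈ˡ map (outside ∷_) (allSubsets n) × p ∈ˡ map (inside ∷_) (allSubsets n))
  disjoint (p∈outs , p∈ins) with ∈-map⁻ (outside ∷_) p∈outs | ∈-map⁻ (inside ∷_) p∈ins
  ... | _ , _ , refl | _ , _ , ()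

PrefixDecomposable : ℕ → Cx N → List (Subset N) → Set₁
PrefixDecomposable k K Fs = ∀ xs ys → xs ++ ys ≡ Fs → KDecomposable k (K +⟨ xs ⟩)

prefix-[] : KDecomposable k K → PrefixDecomposable k K []
prefix-[] decK [] _ _ = KDecomposable-resp-≐ (≐-sym +⟨[]⟩) decK

prefix-∷ : KDecomposable k K → PrefixDecomposable k (K ⊕ F) Fs → PrefixDecomposable k K (F ∷ Fs)
prefix-∷ decK _ [] _ _ = KDecomposable-resp-≐ (≐-sym +⟨[]⟩) decK
prefix-∷ decK prefixes (x ∷ xs) ys eq with List.∷-injective eq
... | refl , eq′ = KDecomposable-resp-≐ (≐-sym +⟨∷⟩) (prefixes xs ys eq′)

prefix-++ : PrefixDecomposable k K Fs → PrefixDecomposable k (K +⟨ Fs ⟩) Gs → PrefixDecomposable k K (Fs ++ Gs)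
prefix-++ {Fs = Fs} {Gs = Gs} prefixesF prefixesG xs ys eq with split-++ xs ys Fs Gs eq
... | inj₁ (zs , xs++zs≡Fs) = prefixesF xs zs xs++zs≡Fs
... | inj₂ (ws , refl , ws++ys≡Gs) = KDecomposable-resp-≐ (≐-sym (+⟨++⟩ Fs)) (prefixesG ws ys ws++ys≡Gs)

prefix-all : PrefixDecomposable k K Fs → KDecomposable k (K +⟨ Fs ⟩)
prefix-all {Fs = Fs} prefixes = prefixes Fs [] (List.++-identityʳ Fs)

record Extension (k : ℕ) (K : Cx N) (T : Subset N) (c : ℕ) (Fs : List (Subset N)) : Set₁ where
  field
    prefixes : PrefixDecomposable k K Fs
    unique   : Unique Fs
    new      : ∀ {F} → F ∈ˡ Fs → F ⊆ T × ∣ F ∣ ≡ c × ¬ K F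

record FullExtension (k : ℕ) (K : Cx N) (T : Subset N) (c : ℕ) (Fs : List (Subset N)) : Set₁ where
  field
    extension : Extension k K T c Fs
    complete  : ∀ F → F ⊆ T → ∣ F ∣ ≡ c → ¬ K F → F ∈ˡ Fs
  open Extension extension public

∈⇒⟨⟩ : F ∈ˡ Fs → ⟨ Fs ⟩ F
∈⇒⟨⟩ F∈Fs = lose F∈Fs ⊆-refl

FullExtension-++ : ∀ {A B} → Extension k K T c A → FullExtension k (K +⟨ A ⟩) T c B →
                   FullExtension k K T c (A ++ B)
FullExtension-++ {K = K} {T = T} {c = c} {A = A} {B = B} extA fullB = record
  { extension = record
    { prefixes = prefix-++ A.prefixes B.prefixes
    ; unique = Unique.++⁺ A.unique B.unique λ (F∈A , F∈B) → proj₂ (proj₂ (B.new F∈B)) (inj₂ (∈⇒⟨⟩ F∈A))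
    ; new = [ A.new , (λ F∈B → Product.map₂ (Product.map₂ (_∘ inj₁)) (B.new F∈B)) ]′ ∘ ∈-++⁻ A
    }
  ; complete = complete
  }
  where
  module A = Extension extA
  module B = FullExtension fullB
  complete : ∀ F → F ⊆ T → ∣ F ∣ ≡ c → ¬ K F → F ∈ˡ A ++ B
  complete F F⊆T ∣F∣≡c ¬KF with Any.any? (F ≟ˢ_) A
  ... | yes F∈A = ∈-++⁺ˡ F∈A
  ... | no F∉A = ∈-++⁺ʳ A (B.complete F F⊆T ∣F∣≡c [ ¬KF , F∉⟨A⟩ ]′)
    where
    F∉⟨A⟩ : ¬ ⟨ A ⟩ F
    F∉⟨A⟩ ⟨A⟩F with find ⟨A⟩F
    ... | L , L∈A , F⊆L with ⊆∧∣∣≡⇒≡ F⊆L (trans ∣F∣≡c (sym (proj₁ (proj₂ (A.new L∈A)))))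
    ... | refl = F∉A L∈A

fill-prefixes : IsComplex K → Decidable K → PureCard K c → KDecomposable k K → Unique Fs →
                (∀ {F} → F ∈ˡ Fs → Fillable K c F) → PrefixDecomposable k K Fs
fill-prefixes isC K? pure decK [] _ = prefix-[] decK
fill-prefixes {K = K} {c = c} {Fs = F ∷ Fs} isC K? pure decK (F∉Fs ∷ unique) fillable =
  prefix-∷ decK (fill-prefixes (⊕-isComplex F isC) (⊕? F K?) (⊕-pure pure ∣F∣≡c)
                   (⊕-decomposable isC K? pure decK (fillable (here refl))) unique
                   λ G∈Fs → Fillable-⊕ {K = K} ∣F∣≡c (All.lookup F∉Fs G∈Fs ∘ sym) (fillable (there G∈Fs)))
  where
  ∣F∣≡c : ∣ F ∣ ≡ c
  ∣F∣≡c = proj₁ (fillable (here refl))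

fill-over-ridges : ∀ T → IsComplex K → Decidable K → PureCard K (suc c) → KDecomposable k K →
       (∀ R → R ⊆ T → ∣ R ∣ ≡ c → K R) → ∃ (FullExtension k K T (suc c))
fill-over-ridges {K = K} {c = c} T isC K? pure decK all-ridges = missing , record
  { extension = record
    { prefixes = fill-prefixes isC K? pure decK unique fillable ; unique = unique ; new = new }
  ; complete = λ F F⊆T ∣F∣≡ ¬KF → ∈-filter⁺ missing? (∈-allSubsets F) (F⊆T , ∣F∣≡ , ¬KF)
  }
  where
  missing? : ∀ F → Dec (F ⊆ T × ∣ F ∣ ≡ suc c × ¬ K F)
  missing? F = (F ⊆? T) ×-dec ((∣ F ∣ ℕ.≟ suc c) ×-dec ¬? (K? F))
  missing : List (Subset _)
  missing = filter missing? (allSubsets _)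
  unique : Unique missing
  unique = Unique.filter⁺ missing? (allSubsets-unique _)
  new : ∀ {F} → F ∈ˡ missing → F ⊆ T × ∣ F ∣ ≡ suc c × ¬ K F
  new F∈missing = proj₂ (∈-filter⁻ missing? {xs = allSubsets _} F∈missing)
  fillable : ∀ {F} → F ∈ˡ missing → Fillable K (suc c) F
  fillable {F} F∈missing =
    let F⊆T , ∣F∣≡1+c , ¬KF = new F∈missing
    in ∣F∣≡1+c , ¬KF , λ x∈F → all-ridges _ (⊆-trans (p-x⊆p F _) F⊆T) (∣p-x∣≡ {p = F} x∈F ∣F∣≡1+c)

-- Decomposable orderings of facets

NonemptyPrefixDecomposable : ℕ → List (Subset N) → Set₁
NonemptyPrefixDecomposable k Fs = ∀ F xs ys → (F ∷ xs) ++ ys ≡ Fs → KDecomposable k ⟨ F ∷ xs ⟩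

record FacetOrder (k : ℕ) (Q : Cx N) (c : ℕ) : Set₁ where
  field
    facets    : List (Subset N)
    unique    : Unique facets
    cards     : AllCard c facets
    generates : ⟨ facets ⟩ ≐ Q
    prefixes  : NonemptyPrefixDecomposable k facets

module Glue {Q : Cx N} {σ : Subset N} (isQ : IsComplex Q) (Ds≐del : ⟨ Ds ⟩ ≐ del σ Q)
            (Ws⊆lk : ∀ {B} → B ∈ˡ Ws → lk σ Q B) where

  Ws#σ : ∀ {B} → B ∈ˡ Ws → Disjoint B σ
  Ws#σ B∈Ws = ∩≡⊥⇒disjoint (proj₁ (proj₂ (Ws⊆lk B∈Ws)))

  ⟨++map∪⟩⊆ : ⟨ Ds ++ map (_∪ σ) Ws ⟩ G → Q G
  ⟨++map∪⟩⊆ ⟨⟩G with find ⟨⟩G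
  ... | L , L∈ , G⊆L with ∈-++⁻ Ds L∈
  ... | inj₁ L∈Ds = isQ L _ G⊆L (proj₁ (proj₁ Ds≐del (∈⇒⟨⟩ L∈Ds)))
  ... | inj₂ L∈map with ∈-map⁻ (_∪ σ) L∈map
  ... | B , B∈Ws , refl = isQ _ _ G⊆L (proj₂ (proj₂ (Ws⊆lk B∈Ws)))

  ⊆⟨++map∪⟩ : (∀ {G} → lk σ Q G → ⟨ Ws ⟩ G) → ∀ {G} → Q G → ⟨ Ds ++ map (_∪ σ) Ws ⟩ G
  ⊆⟨++map∪⟩ lk⊆Ws {G} QG with σ ⊆? G
  ... | no σ⊈G = Any.++⁺ˡ (proj₂ Ds≐del (QG , σ⊈G))
  ... | yes σ⊆G with find (lk⊆Ws (lk-intro isQ QG (∪-lub (p─q⊆p G σ) σ⊆G) (x∈p─q⇒x∉q G σ)))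
  ... | B , B∈Ws , G─σ⊆B = Any.++⁺ʳ Ds (lose (∈-map⁺ (_∪ σ) B∈Ws) (⊆-trans (p⊆p─q∪q G σ) (∪-monoˡ σ G─σ⊆B)))

  ⟨++map∪⟩-unique : Unique Ds → Unique Ws → Unique (Ds ++ map (_∪ σ) Ws)
  ⟨++map∪⟩-unique uniqueDs uniqueWs =
    Unique.++⁺ uniqueDs (Unique-map⁺ (λ B∈ B′∈ → ∪-cancelʳ (Ws#σ B∈) (Ws#σ B′∈)) uniqueWs) Ds#Ws∪σ
    where
    Ds#Ws∪σ : ∀ {F} → ¬ (F ∈ˡ Ds × F ∈ˡ map (_∪ σ) Ws)
    Ds#Ws∪σ (F∈Ds , F∈map) with ∈-map⁻ (_∪ σ) F∈map
    ... | B , _ , refl = proj₂ (proj₁ Ds≐del (∈⇒⟨⟩ F∈Ds)) (q⊆p∪q B σ)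

  ⟨++map∪⟩-cards : ∀ {cL} → AllCard c Ds → AllCard cL Ws → cL + ∣ σ ∣ ≡ c → AllCard c (Ds ++ map (_∪ σ) Ws)
  ⟨++map∪⟩-cards cardsDs cardsWs cL+∣σ∣≡c F∈ with ∈-++⁻ Ds F∈
  ... | inj₁ F∈Ds = cardsDs F∈Ds
  ... | inj₂ F∈map with ∈-map⁻ (_∪ σ) F∈map
  ... | B , B∈Ws , refl = trans (∣p∪q∣≡∣p∣+∣q∣ B σ (Ws#σ B∈Ws)) (trans (cong (_+ ∣ σ ∣) (cardsWs B∈Ws)) cL+∣σ∣≡c)

  del-⟨++map∪⟩ : del σ ⟨ Ds ++ map (_∪ σ) Ws ⟩ ≐ del σ Q
  del-⟨++map∪⟩ = Product.map₁ ⟨++map∪⟩⊆ , λ delG → Any.++⁺ˡ (proj₂ Ds≐del delG) , proj₂ delG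

  lk-⟨++map∪⟩ : lk σ ⟨ Ds ++ map (_∪ σ) Ws ⟩ ≐ ⟨ Ws ⟩
  lk-⟨++map∪⟩ = to , from
    where
    to : lk σ ⟨ Ds ++ map (_∪ σ) Ws ⟩ G → ⟨ Ws ⟩ G
    to (_ , G∩σ≡⊥ , ⟨⟩G∪σ) with find ⟨⟩G∪σ
    ... | L , L∈ , G∪σ⊆L with ∈-++⁻ Ds L∈
    ... | inj₁ L∈Ds = ⊥-elim (proj₂ (proj₁ Ds≐del (∈⇒⟨⟩ L∈Ds)) (⊆-trans (q⊆p∪q _ σ) G∪σ⊆L))
    ... | inj₂ L∈map with ∈-map⁻ (_∪ σ) L∈map
    ... | B , B∈Ws , refl = lose B∈Ws λ y∈G →
          [ id , ⊥-elim ∘ ∩≡⊥⇒disjoint G∩σ≡⊥ y∈G ]′ (x∈p∪q⁻ B σ (G∪σ⊆L (p⊆p∪q σ y∈G)))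
    from : ⟨ Ws ⟩ G → lk σ ⟨ Ds ++ map (_∪ σ) Ws ⟩ G
    from ⟨Ws⟩G with find ⟨Ws⟩G
    ... | B , B∈Ws , G⊆B =
      lk-intro (⟨⟩-isComplex _) (Any.++⁺ʳ Ds (lose (∈-map⁺ (_∪ σ) B∈Ws) ⊆-refl)) (∪-monoˡ σ G⊆B) (Ws#σ B∈Ws ∘ G⊆B)

  ⟨++map∪⟩-decomposable : PureCard (del σ Q) c → KDecomposable k (del σ Q) → Nonempty σ → ∣ σ ∣ ≤ suc k →
                          AllCard c (Ds ++ map (_∪ σ) Ws) → ∀ {W} → W ∈ˡ Ws → KDecomposable k ⟨ Ws ⟩ →
                          KDecomposable k ⟨ Ds ++ map (_∪ σ) Ws ⟩
  ⟨++map∪⟩-decomposable pureDel decDel σ≢∅ ∣σ∣≤ cards {W} W∈Ws decWs =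
    shed-≐ (⟨⟩-pure W∪σ∈ cards) (lose W∪σ∈ (q⊆p∪q _ σ)) σ≢∅ ∣σ∣≤ del-⟨++map∪⟩ pureDel decDel lk-⟨++map∪⟩ decWs
    where
    W∪σ∈ : W ∪ σ ∈ˡ Ds ++ map (_∪ σ) Ws
    W∪σ∈ = ∈-++⁺ʳ Ds (∈-map⁺ (_∪ σ) W∈Ws)

-- First the facets of del σ Q, then σ ∪ B for the facets B of lk σ Q: a prefix reaching into
-- the second part is shed at σ, with deletion del σ Q and a prefix of the order of lk σ Q as link.
facet-order : IsComplex Q → Decidable Q → PureCard Q c → KDecomposable k Q → FacetOrder k Q c
facet-order isQ Q? pure (simplex _ _ (S , facetS , unique)) = record
  { facets = S ∷ []
  ; unique = [] ∷ []
  ; cards = λ { (here refl) → proj₂ pure S facetS ; (there ()) }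
  ; generates = ≐-sym (simplex≐⟨facet⟩ isQ Q? facetS unique)
  ; prefixes = λ { _ [] [] refl → ⟨simplex⟩-decomposable S ; _ [] (_ ∷ _) () ; _ (_ ∷ _) _ () }
  }
facet-order {Q = Q} {c = c} {k = k} isQ Q? pure (shed _ pure′ σ Qσ σ≢∅ ∣σ∣≤ pureDel decLk decDel) = record
  { facets = D.facets ++ map (_∪ σ) L.facets
  ; unique = ⟨++map∪⟩-unique D.unique L.unique
  ; cards = ⟨++map∪⟩-cards D.cards L.cards (lk-card isQ pure pureLk)
  ; generates = ⟨++map∪⟩⊆ , ⊆⟨++map∪⟩ (proj₂ L.generates)
  ; prefixes = prefixes
  }
  where
  pureDel′ : PureCard (del σ Q) c
  pureDel′ = PureCard-via pure pure′ pureDel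
  pureLk : PureCard (lk σ Q) (proj₁ (KDecomposable⇒pure decLk))
  pureLk = proj₂ (KDecomposable⇒pure decLk)
  module D = FacetOrder (facet-order (del-isComplex σ isQ) (del? σ Q?) pureDel′ decDel)
  module L = FacetOrder (facet-order (lk-isComplex σ isQ) (lk? σ Q?) pureLk decLk)
  L⊆lk : ∀ {B} → B ∈ˡ L.facets → lk σ Q B
  L⊆lk B∈ = proj₁ L.generates (∈⇒⟨⟩ B∈)
  open Glue isQ D.generates L⊆lk
  prefixes : NonemptyPrefixDecomposable k (D.facets ++ map (_∪ σ) L.facets)
  prefixes F xs ys eq with split-++ (F ∷ xs) ys D.facets (map (_∪ σ) L.facets) eq
  ... | inj₁ (zs , eq′) = D.prefixes F xs zs eq′
  ... | inj₂ (ws , F∷xs≡ , ws++ys≡) with split-++-map (_∪ σ) ws ys L.facets ws++ys≡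
  ... | [] , _ , _ , refl =
    subst (KDecomposable k ∘ ⟨_⟩) (sym (trans F∷xs≡ (List.++-identityʳ D.facets)))
      (KDecomposable-resp-≐ (≐-sym D.generates) decDel)
  ... | w ∷ W , ys′ , L≡ , refl =
    subst (KDecomposable k ∘ ⟨_⟩) (sym F∷xs≡)
      (Glue.⟨++map∪⟩-decomposable isQ D.generates (L⊆lk ∘ W⊆L) pureDel′ decDel σ≢∅ ∣σ∣≤
         (Glue.⟨++map∪⟩-cards isQ D.generates (L⊆lk ∘ W⊆L) D.cards (L.cards ∘ W⊆L) (lk-card isQ pure pureLk))
         (here refl) (L.prefixes w W ys′ (sym L≡)))
    where
    W⊆L : ∀ {B} → B ∈ˡ w ∷ W → B ∈ˡ L.facets
    W⊆L B∈ = subst (_ ∈ˡ_) (sym L≡) (∈-++⁺ˡ B∈)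

-- Gluing cones

+⟨map∪⁅⁆⟩≐∪ᶜcone : ∀ {Bs} → C +⟨ map (_∪ ⁅ h ⁆) Bs ⟩ ≐ C ∪ᶜ cone h ⟨ Bs ⟩
+⟨map∪⁅⁆⟩≐∪ᶜcone {h = h} {Bs = Bs} = Sum.map₂ (proj₂ (cone-⟨⟩ h Bs)) , Sum.map₂ (proj₁ (cone-⟨⟩ h Bs))

+⟨cones⟩+⟨cones⟩≐ : ∀ {M : Cx N} {Bs Ws} → ⟨ Bs ⟩ ≐ M →
                   (C +⟨ map (_∪ ⁅ h ⁆) Bs ⟩) +⟨ map (_∪ ⁅ h ⁆) Ws ⟩ ≐ C ∪ᶜ cone h (M +⟨ Ws ⟩)
+⟨cones⟩+⟨cones⟩≐ {h = h} {Bs = Bs} {Ws = Ws} (Bs⊆M , M⊆Bs) =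
    (λ { (inj₁ (inj₁ CG)) → inj₁ CG
       ; (inj₁ (inj₂ ⟨Bs∪h⟩G)) → inj₂ (inj₁ (Bs⊆M (proj₂ (cone-⟨⟩ h Bs) ⟨Bs∪h⟩G)))
       ; (inj₂ ⟨Ws∪h⟩G) → inj₂ (inj₂ (proj₂ (cone-⟨⟩ h Ws) ⟨Ws∪h⟩G)) })
  , (λ { (inj₁ CG) → inj₁ (inj₁ CG)
       ; (inj₂ (inj₁ MG-h)) → inj₁ (inj₂ (proj₁ (cone-⟨⟩ h Bs) (M⊆Bs MG-h)))
       ; (inj₂ (inj₂ ⟨Ws⟩G-h)) → inj₂ (proj₁ (cone-⟨⟩ h Ws) ⟨Ws⟩G-h) })

module _ {C M : Cx N} {h : Fin N} (isC : IsComplex C) (isM : IsComplex M)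
         (avoidsC : Avoids h C) (avoidsM : Avoids h M) where

  del-apex : (∀ {G} → M G → C G) → del ⁅ h ⁆ (C ∪ᶜ cone h M) ≐ C
  del-apex M⊆C = to , λ CG → inj₁ CG , λ h⊆G → avoidsC CG (h⊆G (x∈⁅x⁆ h))
    where
    to : del ⁅ h ⁆ (C ∪ᶜ cone h M) G → C G
    to (inj₁ CG , _) = CG
    to (inj₂ MG-h , h⊈G) = isC _ _ (p⊆q-x ⊆-refl (h⊈G ∘ ⁅x⁆⊆p)) (M⊆C MG-h)

  lk-apex : lk ⁅ h ⁆ (C ∪ᶜ cone h M) ≐ M
  lk-apex = to , from
    where
    to : lk ⁅ h ⁆ (C ∪ᶜ cone h M) G → M G
    to (_ , _ , inj₁ CG∪h) = ⊥-elim (avoidsC CG∪h (q⊆p∪q _ ⁅ h ⁆ (x∈⁅x⁆ h)))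
    to {G} (_ , G∩h≡⊥ , inj₂ M[G∪h]-h) =
      isM _ G (p⊆q-x (p⊆p∪q ⁅ h ⁆) λ h∈G → ∩≡⊥⇒disjoint G∩h≡⊥ h∈G (x∈⁅x⁆ h)) M[G∪h]-h
    from : M G → lk ⁅ h ⁆ (C ∪ᶜ cone h M) G
    from {G} MG =
      inj₂ (isM _ _ (p-x⊆p G h) MG) , disjoint⇒∩≡⊥ (∉⇒disjoint⁅⁆ (avoidsM MG)) , inj₂ (isM _ _ (p∪⁅x⁆-x⊆p G h) MG)

-- The apex h is shed: its deletion is C and its link is ⟨ Bs ⟩.
+⟨cones⟩-decomposable : ∀ {Bs B} → IsComplex C → PureCard C (suc c) → KDecomposable k C → Avoids h C →
  (∀ {B} → B ∈ˡ Bs → C B × ∣ B ∣ ≡ c × h ∉ B) → B ∈ˡ Bs → KDecomposable k ⟨ Bs ⟩ →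
  KDecomposable k (C +⟨ map (_∪ ⁅ h ⁆) Bs ⟩)
+⟨cones⟩-decomposable {C = C} {c = c} {h = h} {Bs = Bs} isC pure decC avoidsC Bs⊆C B∈Bs decBs =
  KDecomposable-resp-≐ (≐-sym +⟨map∪⁅⁆⟩≐∪ᶜcone)
    (shed-≐ (PureCard-resp-≐ +⟨map∪⁅⁆⟩≐∪ᶜcone (+⟨⟩-pure pure cards)) (inj₂ (lose B∈Bs (⁅x⁆-x⊆p h)))
       (h , x∈⁅x⁆ h) (subst (_≤ suc _) (sym (∣⁅x⁆∣≡1 h)) (s≤s z≤n))
       (del-apex isC isBs avoidsC avoidsBs ⟨Bs⟩⊆C) pure decC (lk-apex isC isBs avoidsC avoidsBs) decBs)
  where
  isBs : IsComplex ⟨ Bs ⟩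
  isBs = ⟨⟩-isComplex Bs
  ⟨Bs⟩⊆C : ⟨ Bs ⟩ G → C G
  ⟨Bs⟩⊆C ⟨Bs⟩G = let B , B∈Bs , G⊆B = find ⟨Bs⟩G in isC _ _ G⊆B (proj₁ (Bs⊆C B∈Bs))
  avoidsBs : Avoids h ⟨ Bs ⟩
  avoidsBs ⟨Bs⟩G h∈G = let B , B∈Bs , G⊆B = find ⟨Bs⟩G in proj₂ (proj₂ (Bs⊆C B∈Bs)) (G⊆B h∈G)
  cards : AllCard (suc c) (map (_∪ ⁅ h ⁆) Bs)
  cards F∈ with ∈-map⁻ (_∪ ⁅ h ⁆) F∈
  ... | B , B∈Bs , refl = let _ , ∣B∣≡c , h∉B = Bs⊆C B∈Bs in trans (∣p∪⁅x⁆∣≡1+∣p∣ h∉B) (cong suc ∣B∣≡c)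

-- The facets of C are attached one at a time to the decomposable cone over M, which contains
-- their boundaries.
cone-over-skeleton-decomposable :
  IsComplex C → Decidable C → PureCard C (suc c) → Avoids h C →
  IsComplex M → Decidable M → PureCard M c → KDecomposable k M → Avoids h M →
  (∀ {G} → skel (suc c) C G → M G) → KDecomposable k (C ∪ᶜ cone h M)
cone-over-skeleton-decomposable {C = C} {c = c} {h = h} {M = M}
                                isC C? pureC avoidsC isM M? pureM decM avoidsM skel⊆M =
  KDecomposable-resp-≐ ≐C∪ᶜcone
    (prefix-all (fill-prefixes (cone-isComplex h isM) (cone? h M?) (cone-pure isM avoidsM pureM)
                               (cone-decomposable isM M? avoidsM decM)
                               (Unique.filter⁺ facet? (allSubsets-unique _)) fillable))
  where
  facet? : ∀ F → Dec (C F × ∣ F ∣ ≡ suc c)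
  facet? F = C? F ×-dec (∣ F ∣ ℕ.≟ suc c)
  facets : List (Subset _)
  facets = filter facet? (allSubsets _)
  fillable : ∀ {F} → F ∈ˡ facets → Fillable (cone h M) (suc c) F
  fillable {F} F∈ =
    let CF , ∣F∣≡1+c = proj₂ (∈-filter⁻ facet? {xs = allSubsets _} F∈)
    in ∣F∣≡1+c
     , (λ MF-h → ℕ.<⇒≱ (subst (c <_) (sym ∣F∣≡1+c) (ℕ.n<1+n c))
                        (face-card≤ isM M? pureM (isM _ F (p⊆q-x ⊆-refl (avoidsC CF)) MF-h)))
     , λ {x} x∈F → isM _ _ (p-x⊆p _ h)
                     (skel⊆M ( isC F _ (p-x⊆p F x) CF
                             , subst (_< suc c) (sym (∣p-x∣≡ {p = F} x∈F ∣F∣≡1+c)) (ℕ.n<1+n c)))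
  ≐C∪ᶜcone : cone h M +⟨ facets ⟩ ≐ C ∪ᶜ cone h M
  ≐C∪ᶜcone =
      [ inj₂ , (λ ⟨⟩G → let F , F∈ , G⊆F = find ⟨⟩G
                        in inj₁ (isC F _ G⊆F (proj₁ (proj₂ (∈-filter⁻ facet? {xs = allSubsets _} F∈))))) ]′
    , [ (λ CG → let T , CT , G⊆T , ∣T∣≡ = face⊆maximal-face isC C? pureC CG
                in inj₂ (lose (∈-filter⁺ facet? (∈-allSubsets T) (CT , ∣T∣≡)) G⊆T)) , inj₁ ]′

-- Adding a new vertex

VertexSet : Cx N → Subset N → Set
VertexSet C V = ∀ v → C ⁅ v ⁆ ⇔ v ∈ V

faces⊆vertices : IsComplex C → VertexSet C V → C G → G ⊆ V
faces⊆vertices isC vertices CG {v} v∈G = Equivalence.to (vertices v) (isC _ _ (⁅x⁆⊆p v∈G) CG)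

VertexSet-⊕ : F ⊆ V → VertexSet K V → VertexSet (K ⊕ F) V
VertexSet-⊕ F⊆V vertices v =
  mk⇔ [ Equivalence.to (vertices v) , (λ v⊆F → F⊆V (v⊆F (x∈⁅x⁆ v))) ]′ (inj₁ ∘ Equivalence.from (vertices v))

skel-vertices : VertexSet C V → VertexSet (skel (suc (suc c)) C) V
skel-vertices {c = c} vertices v =
  mk⇔ (Equivalence.to (vertices v) ∘ proj₁)
      λ v∈V → Equivalence.from (vertices v) v∈V , subst (_< 2 + c) (sym (∣⁅x⁆∣≡1 v)) (s≤s (s≤s z≤n))

module ExtensionStep {C : Cx N} {V H : Subset N} {h : Fin N}
            (isC : IsComplex C) (C? : Decidable C) (vertices : VertexSet C V)
            (V#H : Disjoint V H) (h∈H : h ∈ H) (pure : PureCard C (suc c)) (decC : KDecomposable k C) where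

  M₀ : Cx N
  M₀ = skel (suc c) C
  isM₀ : IsComplex M₀
  isM₀ = skel-isComplex (suc c) isC
  M₀? : Decidable M₀
  M₀? = skel? (suc c) C?
  pureM₀ : PureCard M₀ c
  pureM₀ = skel-pure isC C? pure
  decM₀ : KDecomposable k M₀
  decM₀ = skel-decomposable isC C? pure decC

  avoidsC : Avoids h C
  avoidsC CG h∈G = V#H (faces⊆vertices isC vertices CG h∈G) h∈H

  join-h : Subset N → Subset N
  join-h = _∪ ⁅ h ⁆

  cone⊆V∪H : G ⊆ V ∪ (H - h) → join-h G ⊆ V ∪ H
  cone⊆V∪H G⊆ =
    ∪-lub (⊆-trans G⊆ (∪-lub (p⊆p∪q H) (⊆-trans (p-x⊆p H h) (q⊆p∪q V H)))) (⊆-trans (⁅x⁆⊆p h∈H) (q⊆p∪q V H))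

  avoids-V∪H-h : G ⊆ V ∪ (H - h) → h ∉ G
  avoids-V∪H-h G⊆ h∈G = [ (λ h∈V → V#H h∈V h∈H) , (λ h∈H-h → x∉p-x H h h∈H-h) ]′ (x∈p∪q⁻ V (H - h) (G⊆ h∈G))

  cone-unique : ∀ {Bs} → (∀ {B} → B ∈ˡ Bs → h ∉ B) → Unique Bs → Unique (map join-h Bs)
  cone-unique avoids = Unique-map⁺ λ B∈ B′∈ → ∪-cancelʳ (∉⇒disjoint⁅⁆ (avoids B∈)) (∉⇒disjoint⁅⁆ (avoids B′∈))

  module _ (order : FacetOrder k M₀ c) where

    open FacetOrder order
      renaming (facets to Bs; unique to Bs-unique; cards to Bs-cards; generates to Bs≐M₀; prefixes to Bs-prefixes)

    A : List (Subset N)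
    A = map join-h Bs
    K₁ : Cx N
    K₁ = C +⟨ A ⟩

    Bs⊆C : ∀ {B} → B ∈ˡ Bs → C B × ∣ B ∣ ≡ c × h ∉ B
    Bs⊆C B∈ = let CB , _ = proj₁ Bs≐M₀ (∈⇒⟨⟩ B∈) in CB , Bs-cards B∈ , avoidsC CB

    cone-phase : Extension k C (V ∪ H) (suc c) A
    cone-phase = record
      { prefixes = prefixes ; unique = cone-unique (proj₂ ∘ proj₂ ∘ Bs⊆C) Bs-unique ; new = new }
      where
      prefixes : PrefixDecomposable k C A
      prefixes xs ys eq with split-++-map join-h xs ys Bs eq
      ... | [] , _ , _ , refl = KDecomposable-resp-≐ (≐-sym +⟨[]⟩) decC
      ... | w ∷ W , ys′ , Bs≡ , refl =
        +⟨cones⟩-decomposable isC pure decC avoidsC (Bs⊆C ∘ W⊆Bs) (here refl) (Bs-prefixes w W ys′ (sym Bs≡))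
        where
        W⊆Bs : ∀ {B} → B ∈ˡ w ∷ W → B ∈ˡ Bs
        W⊆Bs B∈ = subst (_ ∈ˡ_) (sym Bs≡) (∈-++⁺ˡ B∈)
      new : ∀ {F} → F ∈ˡ A → F ⊆ V ∪ H × ∣ F ∣ ≡ suc c × ¬ C F
      new F∈ with ∈-map⁻ join-h F∈
      ... | B , B∈ , refl = let CB , ∣B∣≡c , h∉B = Bs⊆C B∈ in
          cone⊆V∪H (⊆-trans (faces⊆vertices isC vertices CB) (p⊆p∪q _))
        , trans (∣p∪⁅x⁆∣≡1+∣p∣ h∉B) (cong suc ∣B∣≡c)
        , λ CF → avoidsC CF (q⊆p∪q B ⁅ h ⁆ (x∈⁅x⁆ h))

    module _ {Rs : List (Subset N)} (fullR : FullExtension k M₀ (V ∪ (H - h)) c Rs) where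

      module R = FullExtension fullR

      B : List (Subset N)
      B = map join-h Rs
      K₂ : Cx N
      K₂ = K₁ +⟨ B ⟩

      Rs-avoid : ∀ {R} → R ∈ˡ Rs → h ∉ R
      Rs-avoid = avoids-V∪H-h ∘ proj₁ ∘ R.new

      ridge-phase : Extension k K₁ (V ∪ H) (suc c) B
      ridge-phase = record { prefixes = prefixes ; unique = cone-unique Rs-avoid R.unique ; new = new }
        where
        prefixes : PrefixDecomposable k K₁ B
        prefixes xs ys eq with split-++-map join-h xs ys Rs eq
        ... | ws , ys′ , Rs≡ , refl =
          KDecomposable-resp-≐ (≐-sym (+⟨cones⟩+⟨cones⟩≐ Bs≐M₀))
            (cone-over-skeleton-decomposable isC C? pure avoidsC (+⟨⟩-isComplex ws isM₀) (+⟨⟩? ws M₀?)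
              (+⟨⟩-pure pureM₀ (proj₁ ∘ proj₂ ∘ R.new ∘ ws⊆Rs)) (R.prefixes ws ys′ (sym Rs≡)) avoidsM inj₁)
          where
          ws⊆Rs : ∀ {R} → R ∈ˡ ws → R ∈ˡ Rs
          ws⊆Rs R∈ = subst (_ ∈ˡ_) (sym Rs≡) (∈-++⁺ˡ R∈)
          avoidsM : Avoids h (M₀ +⟨ ws ⟩)
          avoidsM (inj₁ (CG , _)) = avoidsC CG
          avoidsM (inj₂ ⟨ws⟩G) h∈G = let R , R∈ , G⊆R = find ⟨ws⟩G in Rs-avoid (ws⊆Rs R∈) (G⊆R h∈G)
        new : ∀ {F} → F ∈ˡ B → F ⊆ V ∪ H × ∣ F ∣ ≡ suc c × ¬ K₁ F
        new F∈ with ∈-map⁻ join-h F∈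
        ... | R , R∈ , refl = let R⊆ , ∣R∣≡c , ¬M₀R = R.new R∈ in
          cone⊆V∪H R⊆ , trans (∣p∪⁅x⁆∣≡1+∣p∣ (Rs-avoid R∈)) (cong suc ∣R∣≡c) ,
          [ (λ CF → avoidsC CF (q⊆p∪q R ⁅ h ⁆ (x∈⁅x⁆ h)))
          , (λ ⟨A⟩F → ¬M₀R (isM₀ _ R (p⊆q-x (p⊆p∪q ⁅ h ⁆) (Rs-avoid R∈))
                                    (proj₁ Bs≐M₀ (proj₂ (cone-⟨⟩ h Bs) ⟨A⟩F)))) ]′

      1+c≤∣V∪H-h∣ : suc c ≤ ∣ V ∪ (H - h) ∣
      1+c≤∣V∪H-h∣ = let (T₀ , facetT₀) , card = pure in
        subst (_≤ _) (card T₀ facetT₀)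
          (p⊆q⇒∣p∣≤∣q∣ (⊆-trans (faces⊆vertices isC vertices (proj₁ facetT₀)) (p⊆p∪q (H - h))))

      -- R - h extends to a ridge R′ of V ∪ (H - h), which lies in M₀ or in Rs; either way R lies in
      -- the cone over R′.
      ridges-covered : ∀ R → R ⊆ V ∪ H → ∣ R ∣ ≡ c → K₂ R
      ridges-covered R R⊆ ∣R∣≡c
        with intermediate-subset (p-x⊆q∪r-x R V H R⊆) (subst (_ ≤_) ∣R∣≡c (p⊆q⇒∣p∣≤∣q∣ (p-x⊆p R h)))
                                 (ℕ.≤-trans (ℕ.n≤1+n c) 1+c≤∣V∪H-h∣)
      ... | R′ , R-h⊆R′ , R′⊆ , ∣R′∣≡c with M₀? R′
      ... | yes M₀R′ = inj₁ (inj₂ (proj₁ (cone-⟨⟩ h Bs) (proj₂ Bs≐M₀ (isM₀ R′ _ R-h⊆R′ M₀R′))))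
      ... | no ¬M₀R′ = inj₂ (proj₁ (cone-⟨⟩ h Rs) (lose (R.complete R′ R′⊆ ∣R′∣≡c ¬M₀R′) R-h⊆R′))

      extension-step : ∃ (FullExtension k C (V ∪ H) (suc c))
      extension-step =
        let Ss , fullS = fill-over-ridges (V ∪ H) isK₂ (+⟨⟩? B (+⟨⟩? A C?)) pureK₂
                                          (prefix-all (Extension.prefixes ridge-phase)) ridges-covered
        in A ++ (B ++ Ss) , FullExtension-++ cone-phase (FullExtension-++ ridge-phase fullS)
        where
        isK₂ : IsComplex K₂
        isK₂ = +⟨⟩-isComplex B (+⟨⟩-isComplex A isC)
        pureK₂ : PureCard K₂ (suc c)
        pureK₂ = +⟨⟩-pure (+⟨⟩-pure pure (proj₁ ∘ proj₂ ∘ Extension.new cone-phase))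
                          (proj₁ ∘ proj₂ ∘ Extension.new ridge-phase)

-- Two-dimensional complexes

Edge : Cx N → Fin N → Fin N → Set
Edge K a b = K (⁅ a ⁆ ∪ ⁅ b ⁆)

edge-sym : IsComplex K → Edge K a b → Edge K b a
edge-sym {a = a} {b = b} isC = isC _ _ (∪-lub (q⊆p∪q ⁅ a ⁆ ⁅ b ⁆) (p⊆p∪q ⁅ b ⁆))

edge-loop : IsComplex K → K ⁅ a ⁆ → Edge K a a
edge-loop {a = a} isC = isC _ _ (∪-lub ⊆-refl ⊆-refl)

connected : IsComplex K → Decidable K → PureCard K (suc (suc c)) → KDecomposable k K →
            K ⁅ a ⁆ → K ⁅ b ⁆ → Star (Edge K) a b
connected {K = K} isC K? pure (simplex _ _ (S , facetS , unique)) Ka Kb =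
  isC S _ (∪-lub (⟨∷[]⟩⇒⊆ (K⊆S Ka)) (⟨∷[]⟩⇒⊆ (K⊆S Kb))) (proj₁ facetS) ◅ ε
  where
  K⊆S : K G → ⟨ S ∷ [] ⟩ G
  K⊆S = proj₁ (simplex≐⟨facet⟩ isC K? facetS unique)
connected {K = K} {c = c} isC K? pure (shed _ pure′ σ _ σ≢∅ _ pureDel decLk decDel) Ka Kb =
  let a′ , delA′ , a→a′ = step-off Ka
      b′ , delB′ , b→b′ = step-off Kb
  in a→a′ ◅◅ Star.map proj₁ (connected (del-isComplex σ isC) (del? σ K?) (PureCard-via pure pure′ pureDel) decDel
                                       delA′ delB′)
          ◅◅ reverse (edge-sym isC) b→b′
  where
  -- If σ = ⁅ x ⁆, then x is joined to a vertex of a facet of the link, which is nonempty since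
  -- dim K ≥ 1.
  step-off : K ⁅ x ⁆ → ∃ λ x′ → del σ K ⁅ x′ ⁆ × Star (Edge K) x x′
  step-off {x} Kx with σ ⊆? ⁅ x ⁆ | KDecomposable⇒pure decLk
  ... | no σ⊈x | _ = x , (Kx , σ⊈x) , ε
  ... | yes σ⊆x | zero , pureLk =
    ⊥-elim (ℕ.<⇒≱ (s≤s (s≤s z≤n)) (subst₂ _≤_ (lk-card isC pure pureLk) (∣⁅x⁆∣≡1 x) (p⊆q⇒∣p∣≤∣q∣ σ⊆x)))
  ... | yes σ⊆x | suc _ , ((L , facetL@((_ , L∩σ≡⊥ , KL∪σ) , _)) , cardLk)
    with 0<∣p∣⇒nonempty {p = L} (subst (0 <_) (sym (cardLk L facetL)) (s≤s z≤n))
  ... | g , g∈L = g , (isC _ _ (⊆-trans (⁅x⁆⊆p g∈L) (p⊆p∪q σ)) KL∪σ , σ⊈g) , edge ◅ ε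
    where
    x∈σ : x ∈ σ
    x∈σ = let y , y∈σ = σ≢∅ in subst (_∈ σ) (x∈⁅y⁆⇒x≡y x (σ⊆x y∈σ)) y∈σ
    σ⊈g : ¬ σ ⊆ ⁅ g ⁆
    σ⊈g σ⊆g = ∩≡⊥⇒disjoint L∩σ≡⊥ g∈L (subst (_∈ σ) (x∈⁅y⁆⇒x≡y g (σ⊆g x∈σ)) x∈σ)
    edge : Edge K x g
    edge = isC _ _ (∪-lub (⊆-trans (⁅x⁆⊆p x∈σ) (q⊆p∪q L σ)) (⊆-trans (⁅x⁆⊆p g∈L) (p⊆p∪q σ))) KL∪σ

OpenWedge : Cx N → Set
OpenWedge K = ∃ λ a → ∃ λ x → ∃ λ b → Edge K a x × Edge K x b × ¬ Edge K a b

open-wedge : Decidable K → Edge K a x → Star (Edge K) x b → ¬ Edge K a b → OpenWedge K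
open-wedge K? ax ε ¬ab = ⊥-elim (¬ab ax)
open-wedge {a = a} K? ax (_◅_ {j = y} xy yb) ¬ab with K? (⁅ a ⁆ ∪ ⁅ y ⁆)
... | yes ay = open-wedge K? ay yb ¬ab
... | no ¬ay = _ , _ , _ , ax , xy , ¬ay

path⇒open-wedge : IsComplex K → Decidable K → K ⁅ a ⁆ → Star (Edge K) a b → ¬ Edge K a b → OpenWedge K
path⇒open-wedge isC K? Ka ε ¬aa = ⊥-elim (¬aa (edge-loop isC Ka))
path⇒open-wedge isC K? Ka (ax ◅ xb) ¬ab = open-wedge K? ax xb ¬ab

triangle : Fin N → Fin N → Fin N → Subset N
triangle a x b = (⁅ a ⁆ ∪ ⁅ b ⁆) ∪ ⁅ x ⁆

∈-triangle⁻ : ∀ {z} → z ∈ triangle a x b → z ≡ a ⊎ z ≡ b ⊎ z ≡ x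
∈-triangle⁻ {a = a} {x = x} {b = b} {z = z} z∈ with x∈p∪q⁻ (⁅ a ⁆ ∪ ⁅ b ⁆) ⁅ x ⁆ z∈
... | inj₂ z∈x = inj₂ (inj₂ (x∈⁅y⁆⇒x≡y x z∈x))
... | inj₁ z∈ab = Sum.map (x∈⁅y⁆⇒x≡y a) (inj₁ ∘ x∈⁅y⁆⇒x≡y b) (x∈p∪q⁻ ⁅ a ⁆ ⁅ b ⁆ z∈ab)

module _ {K : Cx N} (isC : IsComplex K) {a x b : Fin N}
         (ax : Edge K a x) (xb : Edge K x b) (¬ab : ¬ Edge K a b) where

  private
    a≢b : a ≢ b
    a≢b refl = ¬ab (isC _ _ (∪-lub (p⊆p∪q ⁅ x ⁆) (p⊆p∪q ⁅ x ⁆)) ax)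
    x≢a : x ≢ a
    x≢a refl = ¬ab xb
    x≢b : x ≢ b
    x≢b refl = ¬ab ax
    ∣ab∣≡2 : ∣ ⁅ a ⁆ ∪ ⁅ b ⁆ ∣ ≡ 2
    ∣ab∣≡2 = trans (∣p∪⁅x⁆∣≡1+∣p∣ (a≢b ∘ sym ∘ x∈⁅y⁆⇒x≡y a)) (cong suc (∣⁅x⁆∣≡1 a))
    boundary : ∀ {y} → y ∈ ⁅ a ⁆ ∪ ⁅ b ⁆ → K (triangle a x b - y)
    boundary {y} y∈ab with x∈p∪q⁻ ⁅ a ⁆ ⁅ b ⁆ y∈ab
    ... | inj₁ y∈a rewrite x∈⁅y⁆⇒x≡y a y∈a = isC _ _ (λ z∈ → case ∈-triangle⁻ (p-x⊆p _ a z∈) of λ where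
            (inj₁ refl) → ⊥-elim (x∉p-x _ _ z∈)
            (inj₂ (inj₁ refl)) → q⊆p∪q ⁅ x ⁆ ⁅ b ⁆ (x∈⁅x⁆ b)
            (inj₂ (inj₂ refl)) → p⊆p∪q ⁅ b ⁆ (x∈⁅x⁆ x)) xb
    ... | inj₂ y∈b rewrite x∈⁅y⁆⇒x≡y b y∈b = isC _ _ (λ z∈ → case ∈-triangle⁻ (p-x⊆p _ b z∈) of λ where
            (inj₁ refl) → p⊆p∪q ⁅ x ⁆ (x∈⁅x⁆ a)
            (inj₂ (inj₁ refl)) → ⊥-elim (x∉p-x _ _ z∈)
            (inj₂ (inj₂ refl)) → q⊆p∪q ⁅ a ⁆ ⁅ x ⁆ (x∈⁅x⁆ x)) ax

  ∣triangle∣≡3 : ∣ triangle a x b ∣ ≡ 3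
  ∣triangle∣≡3 =
    trans (∣p∪⁅x⁆∣≡1+∣p∣ λ x∈ab → [ x≢a ∘ x∈⁅y⁆⇒x≡y a , x≢b ∘ x∈⁅y⁆⇒x≡y b ]′ (x∈p∪q⁻ ⁅ a ⁆ ⁅ b ⁆ x∈ab))
          (cong suc ∣ab∣≡2)

  triangle⊆ : (∀ {G} → K G → G ⊆ V) → triangle a x b ⊆ V
  triangle⊆ K⊆V =
    ∪-lub (∪-lub (⊆-trans (p⊆p∪q ⁅ x ⁆) (K⊆V ax)) (⊆-trans (q⊆p∪q ⁅ x ⁆ ⁅ b ⁆) (K⊆V xb)))
          (⊆-trans (p⊆p∪q ⁅ b ⁆) (K⊆V xb))

  triangle-new : ¬ K (triangle a x b)
  triangle-new K△ = ¬ab (isC _ _ (p⊆p∪q ⁅ x ⁆) K△)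

  ⊕triangle-decomposable : PureCard K 3 → KDecomposable (suc k) K → KDecomposable (suc k) (K ⊕ triangle a x b)
  ⊕triangle-decomposable pure decK =
    ⊕-decomposable-shedding-new-face isC pure decK ∣triangle∣≡3 (p⊆p∪q ⁅ x ⁆) (a , p⊆p∪q ⁅ b ⁆ (x∈⁅x⁆ a))
      (subst (_≤ 2 + _) (sym ∣ab∣≡2) (s≤s (s≤s z≤n))) ¬ab boundary

MissingTriangle : Subset N → Cx N → Subset N → Set
MissingTriangle V K F = F ⊆ V × ∣ F ∣ ≡ 3 × ¬ K F

missing-triangle? : ∀ {K : Cx N} V → Decidable K → Decidable (MissingTriangle V K)
missing-triangle? V K? F = (F ⊆? V) ×-dec ((∣ F ∣ ℕ.≟ 3) ×-dec ¬? (K? F))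

missing-triangles : ∀ {K : Cx N} → Subset N → Decidable K → ℕ
missing-triangles V K? = length (filter (missing-triangle? V K?) (allSubsets _))

CompleteGraph : Cx N → Subset N → Set
CompleteGraph K V = ∀ {a b} → a ∈ V → b ∈ V → Edge K a b

complete-graph⇒ridges : IsComplex K → CompleteGraph K V → ∀ R → R ⊆ V → ∣ R ∣ ≡ 2 → K R
complete-graph⇒ridges isC complete R R⊆V ∣R∣≡2 =
  let a , b , a∈R , b∈R , R⊆ab = ∣p∣≡2⇒⊆pair ∣R∣≡2 in isC _ R R⊆ab (complete (R⊆V a∈R) (R⊆V b∈R))

-- The fuel n bounds the number of missing triangles in V, and each added triangle is one of them.
complete-graph : ∀ n → IsComplex K → (K? : Decidable K) → PureCard K 3 → KDecomposable (suc k) K →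
                 VertexSet K V → missing-triangles V K? < n →
                 ∃ λ Ls → Extension (suc k) K V 3 Ls × CompleteGraph (K +⟨ Ls ⟩) V
complete-graph {K = K} {V = V} (suc n) isC K? pure decK vertices bound
  with any? (λ a → any? (λ b → (a ∈? V) ×-dec ((b ∈? V) ×-dec ¬? (K? (⁅ a ⁆ ∪ ⁅ b ⁆)))))
... | no no-missing-edge = [] , record { prefixes = prefix-[] decK ; unique = [] ; new = λ () } , complete
  where
  complete : CompleteGraph (K +⟨ [] ⟩) V
  complete {a} {b} a∈V b∈V with K? (⁅ a ⁆ ∪ ⁅ b ⁆)
  ... | yes ab = inj₁ ab
  ... | no ¬ab = ⊥-elim (no-missing-edge (a , b , a∈V , b∈V , ¬ab))
... | yes (a , b , a∈V , b∈V , ¬ab)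
  with path⇒open-wedge isC K? (vertex a∈V) (connected isC K? pure decK (vertex a∈V) (vertex b∈V)) ¬ab
  where
  vertex : ∀ {v} → v ∈ V → K ⁅ v ⁆
  vertex {v} = Equivalence.from (vertices v)
... | a′ , x , b′ , a′x , xb′ , ¬a′b′ =
  let Ls , ext , complete = complete-graph n (⊕-isComplex △ isC) (⊕? △ K?) (⊕-pure pure ∣△∣≡3)
                              (⊕triangle-decomposable isC a′x xb′ ¬a′b′ pure decK)
                              (VertexSet-⊕ {K = K} △⊆V vertices) fewer-missing
      module E = Extension ext
  in △ ∷ Ls
   , record { prefixes = prefix-∷ decK E.prefixes
            ; unique = All.tabulate (λ G∈ △≡G → proj₂ (proj₂ (E.new G∈)) (inj₂ (subst (_⊆ △) △≡G ⊆-refl)))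
                       ∷ E.unique
            ; new = λ { (here refl) → △⊆V , ∣△∣≡3 , ¬K△
                      ; (there G∈) → Product.map₂ (Product.map₂ (_∘ inj₁)) (E.new G∈) } }
   , λ a∈V b∈V → proj₂ (+⟨∷⟩ {K = K}) (complete a∈V b∈V)
  where
  △ : Subset _
  △ = triangle a′ x b′
  ∣△∣≡3 : ∣ △ ∣ ≡ 3
  ∣△∣≡3 = ∣triangle∣≡3 isC a′x xb′ ¬a′b′
  ¬K△ : ¬ K △
  ¬K△ = triangle-new isC a′x xb′ ¬a′b′
  △⊆V : △ ⊆ V
  △⊆V = triangle⊆ isC a′x xb′ ¬a′b′ (faces⊆vertices isC vertices)
  fewer-missing : missing-triangles V (⊕? △ K?) < n
  fewer-missing = ℕ.<-≤-trans (length-filter-strict (missing-triangle? V K?) (missing-triangle? V (⊕? △ K?))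
                                 (Product.map₂ (Product.map₂ (_∘ inj₁))) (∈-allSubsets △) (△⊆V , ∣△∣≡3 , ¬K△)
                                 (λ (_ , _ , ¬K⊕△) → ¬K⊕△ (inj₂ ⊆-refl)))
                              (ℕ.≤-pred bound)

full-extension-2d : IsComplex C → Decidable C → VertexSet C V → PureCard C 3 → KDecomposable (suc k) C →
                    ∃ (FullExtension (suc k) C V 3)
full-extension-2d isC C? vertices pure decC with complete-graph _ isC C? pure decC vertices (ℕ.n<1+n _)
... | Ls , extL , complete =
  let Ss , fullS = fill-over-ridges _ isK (+⟨⟩? Ls C?) (+⟨⟩-pure pure (proj₁ ∘ proj₂ ∘ Extension.new extL))
                                    (prefix-all (Extension.prefixes extL)) (complete-graph⇒ridges isK complete)
  in Ls ++ Ss , FullExtension-++ extL fullS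
  where
  isK : IsComplex (_ +⟨ Ls ⟩)
  isK = +⟨⟩-isComplex Ls isC

full-extension : ∀ m → IsComplex C → Decidable C → VertexSet C V → Disjoint V H → ∣ H ∣ ≡ m →
                 PureCard C (3 + m) → KDecomposable (suc k) C → ∃ (FullExtension (suc k) C (V ∪ H) (3 + m))
full-extension {C = C} {V = V} {H = H} zero isC C? vertices _ ∣H∣≡0 pure decC =
  subst (λ T → ∃ (FullExtension _ C T 3)) (sym V∪H≡V) (full-extension-2d isC C? vertices pure decC)
  where
  V∪H≡V : V ∪ H ≡ V
  V∪H≡V = trans (cong (V ∪_) (Empty-unique λ (_ , x∈H) → ∣p∣≡0⇒x∉p ∣H∣≡0 x∈H)) (∪-identityʳ V)
full-extension {C = C} {H = H} (suc m) isC C? vertices V#H ∣H∣≡1+m pure decC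
  with 0<∣p∣⇒nonempty (subst (0 <_) (sym ∣H∣≡1+m) (s≤s z≤n))
... | h , h∈H =
  extension-step (facet-order isM₀ M₀? pureM₀ decM₀)
    (proj₂ (full-extension m isM₀ M₀? (skel-vertices {C = C} vertices)
                           (λ v∈V v∈H-h → V#H v∈V (p-x⊆p H h v∈H-h)) (∣p-x∣≡ {p = H} h∈H ∣H∣≡1+m) pureM₀ decM₀))
  where open ExtensionStep isC C? vertices V#H h∈H pure decC

initial : ∀ n m → Subset (n + m)
initial zero m = ⊥
initial (suc n) m = inside ∷ initial n m

∈-initial⇔ : ∀ n m (i : Fin (n + m)) → i ∈ initial n m ⇔ toℕ i < n
∈-initial⇔ n m i = mk⇔ (to n i) (from n i)
  where
  to : ∀ n (i : Fin (n + m)) → i ∈ initial n m → toℕ i < n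
  to zero i i∈⊥ = contradiction i∈⊥ ∉⊥
  to (suc n) zero _ = s≤s z≤n
  to (suc n) (suc i) (there i∈) = s≤s (to n i i∈)
  from : ∀ n (i : Fin (n + m)) → toℕ i < n → i ∈ initial n m
  from (suc n) zero _ = here
  from (suc n) (suc i) (s≤s i<n) = there (from n i i<n)

∣∁initial∣ : ∀ n m → ∣ ∁ (initial n m) ∣ ≡ m
∣∁initial∣ n m = trans (∣∁p∣≡n∸∣p∣ (initial n m)) (trans (cong (n + m ∸_) (∣initial∣ n m)) (ℕ.m+n∸m≡n n m))
  where
  ∣initial∣ : ∀ n m → ∣ initial n m ∣ ≡ n
  ∣initial∣ zero m = ∣⊥∣≡0 m
  ∣initial∣ (suc n) m = cong suc (∣initial∣ n m)

theorem4p10 : (d n : ℕ) → 2 ≤ d →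
    (C : Cx (n + (d ∸ 2))) → IsComplex C → (∀ F → Dec (C F)) →
    (∀ (v : Fin (n + (d ∸ 2))) → C ⁅ v ⁆ ⇔ (toℕ v < n)) →
    PureCard C (suc d) → KDecomposable 1 C →
    Σ (List (Subset (n + (d ∸ 2)))) λ Fs →
      Unique Fs ×
      (∀ F → (F ∈ˡ Fs) ⇔ ((∣ F ∣ ≡ suc d) × ¬ Facet C F)) ×
      (∀ i → 1 ≤ i → i ≤ length Fs → KDecomposable 1 (C +⟨ take i Fs ⟩))
-- With d = 2 + m, the ground set n + (d ∸ 2) and the facet size suc d reduce to n + m and 3 + m.
theorem4p10 (suc (suc m)) n (s≤s (s≤s z≤n)) C isC C? vertices pure decC
  with full-extension m isC C? (λ v → ⇔.trans (vertices v) (⇔.sym (∈-initial⇔ n m v)))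
                      (p#∁p (initial n m)) (∣∁initial∣ n m) pure decC
... | Fs , full =
  Fs , unique , (λ F → mk⇔ (new-facet F) (missing F)) ,
  λ i _ _ → prefixes (take i Fs) (drop i Fs) (List.take++drop≡id i Fs)
  where
  open FullExtension full
  new-facet : ∀ F → F ∈ˡ Fs → ∣ F ∣ ≡ 3 + m × ¬ Facet C F
  new-facet F F∈ = let _ , ∣F∣≡ , ¬CF = new F∈ in ∣F∣≡ , ¬CF ∘ proj₁
  missing : ∀ F → ∣ F ∣ ≡ 3 + m × ¬ Facet C F → F ∈ˡ Fs
  missing F (∣F∣≡ , ¬facet) =
    complete F (subst (F ⊆_) (sym (p∪∁p≡⊤ (initial n m))) ⊆⊤) ∣F∣≡
      (¬facet ∘ λ CF → full-face⇒facet isC C? pure CF ∣F∣≡)
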